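{- Let $p$ be an odd prime and let $f=\sum_j a_jx^{\alpha_j}$, $g=\sum_\ell b_\ell x^{\beta_\ell}\in\mathbb{Z}[x]$ be two polynomials that reduce well modulo $p$. Then for any $k\in\mathbb{N}$ the following three conditions are equivalent: (1) $f$ and $g$ have the same number $t$ of non-zero terms and, up to a permutation of indices, $a_j\equiv b_j\pmod{p^k}$ and $\alpha_j\equiv\beta_j\pmod{\varphi(p^k)}$ for all $j$; (2) $f(x)\equiv g(x)\pmod{p^k}$ for all $x\in\mathbb{Z}$ prime to $p$; (3) $f(i)\equiv g(i)\pmod{p^k}$ for $1\le i\le p-1$ and for $p+1\le i\le 2p-1$.
   Context: A polynomial $f=\sum_j a_jx^{\alpha_j}\in\mathbb{Z}[x]$, written with distinct exponents and all $a_j\ne 0$, reduces well modulo the odd prime $p$ if $p\nmid a_j$ for every $j$ and $p-1\nmid\alpha_j-\alpha_\ell$ for every $j\ne\ell$. $\varphi$ is Euler's totient function. -}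

module Defs where

open import Data.Nat as ℕ using (ℕ; zero; suc)
open import Data.Nat.Coprimality as NC using (coprime?)
open import Data.Integer as ℤ using (ℤ; +_)
open import Data.Integer.Divisibility using (_∣_)
open import Data.Fin using (Fin)
import Data.Fin as Fin
open import Data.List using (List; length; filter; map; upTo)
open import Function.Definitions using (Injective)
open import Relation.Binary.PropositionalEquality using (_≡_)
open import Relation.Nullary using (¬_)
open import Data.Product using (_×_)

φ : ℕ → ℕ
φ n = length (filter (λ i → coprime? i n) (map suc (upTo n)))

_≋_[mod_] : ℤ → ℤ → ℕ → Set
a ≋ b [mod m ] = (+ m) ∣ (a ℤ.- b)

record Poly : Set where
  field
    t        : ℕ
    coeff    : Fin t → ℤ
    expo     : Fin t → ℕ
    distinct : Injective _≡_ _≡_ expo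
    nonzero  : ∀ j → ¬ (coeff j ≡ ℤ.0ℤ)
open Poly public

sumFin : (n : ℕ) → (Fin n → ℤ) → ℤ
sumFin zero    h = ℤ.0ℤ
sumFin (suc n) h = h Fin.zero ℤ.+ sumFin n (λ j → h (Fin.suc j))

eval : Poly → ℤ → ℤ
eval f x = sumFin (t f) (λ j → coeff f j ℤ.* (x ℤ.^ expo f j))

ReducesWell : ℕ → Poly → Set
ReducesWell p f =
  (∀ j → ¬ ((+ p) ∣ coeff f j)) ×
  (∀ j l → ¬ (j ≡ l) → ¬ ((+ (p ℕ.∸ 1)) ∣ ((+ expo f j) ℤ.- (+ expo f l))))
  where open import Data.Product renaming (_×_ to _×_)

{-# OPTIONS --safe #-}
-- For x prime to p, Fermat's little theorem lets the exponents be read modulo p - 1, so modulo p the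
-- values f(1), …, f(p - 1) are those of a polynomial of degree < p - 1 whose coefficients are the sums
-- of the a_j over the residue classes of the exponents; having p - 1 roots, it vanishes.  As f and g
-- reduce well, each class contains at most one term, and this matches the terms of f and g modulo p.
-- To lift the matching from p^(m+1) to p^(m+2), write x^φ(p^(m+1)) = 1 + p^(m+1) A(x): then f(x) - g(x)
-- is p^(m+1) (E(x) + A(x) W(x)) modulo p^(m+2), where E records the differences of the coefficients and
-- W those of the exponents.  For odd p, A(x + p) - A(x) is a unit modulo p, so comparing x = i with
-- x = i + p makes E and W vanish at 1, …, p - 1, so all their coefficients are divisible by p: this is
-- the matching one level up.  The other implications follow from Euler's theorem x^φ(p^k) ≡ 1 (mod p^k).
module Submission where

open import Data.Integer as ℤ using (ℤ; +_; 0ℤ; 1ℤ; _+_; _-_; _*_; -_; _^_)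
import Data.Integer.Properties as ℤ
open import Algebra.Definitions.RawMonoid ℤ.+-0-rawMonoid using () renaming (_×_ to _×ₘ_)
open import Algebra.Definitions.RawSemiring ℤ.+-*-rawSemiring using () renaming (_^_ to _^ₛ_)
open import Algebra.Properties.CommutativeMonoid.Sum ℤ.+-0-commutativeMonoid
  using (sum; sum-cong-≗; ∑-distrib-+; ∑-comm; sum-permute; sum-remove; sum-replicate-zero; sum-init-last)
open import Algebra.Properties.CommutativeSemiring.Binomial ℤ.+-*-commutativeSemiring
  using (binomialTerm) renaming (theorem to binomial-theorem)
open import Algebra.Properties.Semiring.Sum ℤ.+-*-semiring using (*-distribˡ-sum; *-distribʳ-sum)
open import Data.Bool using (if_then_else_)
open import Data.Fin as Fin using (Fin; zero; suc)
import Data.Fin.Permutation as Permutation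
import Data.Fin.Properties as Fin
import Data.Integer.Coprimality as ℤ
open import Data.Integer.Divisibility.Signed
  using (_∣_; divides; ∣ᵤ⇒∣; ∣⇒∣ᵤ; ∣-refl; ∣-trans; ∣m∣n⇒∣m+n; ∣m⇒∣-m; ∣n⇒∣m*n; ∣m⇒∣m*n; *-monoˡ-∣; *-cancelˡ-∣)
open import Data.Integer.Tactic.RingSolver using (solve-∀)
open import Data.List using ([_]; _++_; length; filter; map; upTo)
import Data.List.Properties as List
open import Data.Nat as ℕ using (ℕ; zero; suc; _≤_; _<_; _∸_; NonZero)
open import Data.Nat.Combinatorics
  using (nCk≡n!/k![n-k]!; k![n∸k]!∣n!; nCn≡1; nC1≡n; nCk+nC[k+1]≡[n+1]C[k+1]) renaming (_C_ to _choose_)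
open import Data.Nat.Coprimality using (Coprime; coprime?; coprime-divisor)
import Data.Nat.Divisibility as ℕ
open import Data.Nat.DivMod using (m/n*n≡m; _mod_; _divMod_; DivMod)
open import Data.Nat.Primality using (Prime; euclidsLemma; prime⇒nonZero; prime⇒nonTrivial; prime⇒irreducible)
import Data.Nat.Properties as ℕ
open import Data.Product using (_×_; _,_; proj₁; proj₂; ∃; ∃₂; Σ-syntax)
open import Data.Sum using (_⊎_; inj₁; inj₂)
open import Defs
open import Function using (_∘_)
open import Function.Bundles using (_⤖_; _⇔_; Bijection; mk⤖; mk⇔)
open import Function.Properties.Bijection using (⤖⇒↔)
open import Level using (0ℓ)
open import Relation.Binary.Bundles using (Setoid)
open import Relation.Binary.PropositionalEquality hiding ([_])
open import Relation.Nullary using (¬_; yes; no; does; ¬?; contradiction)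
open import Relation.Unary using (Pred; Decidable)

private variable
  m n k : ℕ
  a b c d x y : ℤ

-- Defs' `_≋_[mod_]` unfolds to a divisibility of absolute values, which unification cannot invert;
-- this record-wrapped variant over signed divisibility is used throughout instead.
infix 4 _≈_[mod_]
record _≈_[mod_] (a b : ℤ) (m : ℕ) : Set where
  constructor mod-intro
  field
    ∣-difference : + m ∣ a - b
open _≈_[mod_] public

≈⇒≋ : a ≈ b [mod m ] → a ≋ b [mod m ]
≈⇒≋ = ∣⇒∣ᵤ ∘ ∣-difference

≋⇒≈ : a ≋ b [mod m ] → a ≈ b [mod m ]
≋⇒≈ = mod-intro ∘ ∣ᵤ⇒∣

∣-≡ : a ≡ b → + m ∣ a → + m ∣ b
∣-≡ = subst (_ ∣_)

∣⇒≡multiple : + m ∣ a → ∃ λ q → a ≡ q * + m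
∣⇒≡multiple (divides q eq) = q , eq

x-y≡z⇒x≡y+z : x - y ≡ c → x ≡ y + c
x-y≡z⇒x≡y+z {x = x} {y = y} {c = c} eq = trans (sym (identity x y)) (cong (_+_ y) eq)
  where
  identity : ∀ x y → y + (x - y) ≡ x
  identity = solve-∀

≈-reflexive : a ≡ b → a ≈ b [mod m ]
≈-reflexive {a = a} refl = mod-intro (divides 0ℤ (ℤ.+-inverseʳ a))

≈-refl : a ≈ a [mod m ]
≈-refl = ≈-reflexive refl

≈-sym : a ≈ b [mod m ] → b ≈ a [mod m ]
≈-sym {a = a} {b = b} (mod-intro p) = mod-intro (∣-≡ (identity a b) (∣m⇒∣-m p))
  where
  identity : ∀ a b → - (a - b) ≡ b - a
  identity = solve-∀

≈-trans : a ≈ b [mod m ] → b ≈ c [mod m ] → a ≈ c [mod m ]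
≈-trans {a = a} {b = b} {c = c} (mod-intro p) (mod-intro q) =
  mod-intro (∣-≡ (identity a b c) (∣m∣n⇒∣m+n p q))
  where
  identity : ∀ a b c → (a - b) + (b - c) ≡ a - c
  identity = solve-∀

≈-setoid : ℕ → Setoid 0ℓ 0ℓ
≈-setoid m = record
  { Carrier       = ℤ
  ; _≈_           = λ a b → a ≈ b [mod m ]
  ; isEquivalence = record { refl = ≈-refl ; sym = ≈-sym ; trans = ≈-trans }
  }

module ≈-Reasoning (m : ℕ) where
  open import Relation.Binary.Reasoning.Setoid (≈-setoid m) public

+-cong-≈ : a ≈ b [mod m ] → c ≈ d [mod m ] → a + c ≈ b + d [mod m ]
+-cong-≈ {a = a} {b = b} {c = c} {d = d} (mod-intro p) (mod-intro q) =
  mod-intro (∣-≡ (identity a b c d) (∣m∣n⇒∣m+n p q))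
  where
  identity : ∀ a b c d → (a - b) + (c - d) ≡ (a + c) - (b + d)
  identity = solve-∀

neg-cong-≈ : a ≈ b [mod m ] → - a ≈ - b [mod m ]
neg-cong-≈ {a = a} {b = b} (mod-intro p) = mod-intro (∣-≡ (identity a b) (∣m⇒∣-m p))
  where
  identity : ∀ a b → - (a - b) ≡ - a - - b
  identity = solve-∀

*-cong-≈ : a ≈ b [mod m ] → c ≈ d [mod m ] → a * c ≈ b * d [mod m ]
*-cong-≈ {a = a} {b = b} {c = c} {d = d} (mod-intro p) (mod-intro q) =
  mod-intro (∣-≡ (identity a b c d) (∣m∣n⇒∣m+n (∣m⇒∣m*n c p) (∣n⇒∣m*n b q)))
  where
  identity : ∀ a b c d → (a - b) * c + b * (c - d) ≡ a * c - b * d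
  identity = solve-∀

+-congˡ-≈ : ∀ a → c ≈ d [mod m ] → a + c ≈ a + d [mod m ]
+-congˡ-≈ a = +-cong-≈ (≈-refl {a = a})

+-congʳ-≈ : ∀ c → a ≈ b [mod m ] → a + c ≈ b + c [mod m ]
+-congʳ-≈ c a≈b = +-cong-≈ a≈b (≈-refl {a = c})

*-congˡ-≈ : ∀ a → c ≈ d [mod m ] → a * c ≈ a * d [mod m ]
*-congˡ-≈ a = *-cong-≈ (≈-refl {a = a})

^-cong-≈ : ∀ n → a ≈ b [mod m ] → a ^ n ≈ b ^ n [mod m ]
^-cong-≈ zero    p = ≈-refl
^-cong-≈ (suc n) p = *-cong-≈ p (^-cong-≈ n p)

≈-weaken : m ℕ.∣ n → a ≈ b [mod n ] → a ≈ b [mod m ]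
≈-weaken m∣n (mod-intro p) = mod-intro (∣-trans (∣ᵤ⇒∣ m∣n) p)

∣⇒≈0 : + m ∣ a → a ≈ 0ℤ [mod m ]
∣⇒≈0 {a = a} = mod-intro ∘ ∣-≡ (sym (ℤ.+-identityʳ a))

x+m≈x : ∀ x → x + + m ≈ x [mod m ]
x+m≈x {m} x = mod-intro (divides 1ℤ (identity x (+ m)))
  where
  identity : ∀ x m → x + m - x ≡ 1ℤ * m
  identity = solve-∀

≈0⇒∣ : a ≈ 0ℤ [mod m ] → + m ∣ a
≈0⇒∣ {a = a} = ∣-≡ (ℤ.+-identityʳ a) ∘ ∣-difference

∣-resp-≈ : a ≈ b [mod m ] → + m ∣ a → + m ∣ b
∣-resp-≈ {a = a} {b = b} (mod-intro p) q = ∣-≡ (identity a b) (∣m∣n⇒∣m+n q (∣m⇒∣-m p))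
  where
  identity : ∀ a b → a + - (a - b) ≡ b
  identity = solve-∀

≈-cancel-factor : ∀ k .{{_ : NonZero k}} → + k * a ≈ + k * b [mod k ℕ.* m ] → a ≈ b [mod m ]
≈-cancel-factor {a = a} {b = b} {m = m} k (mod-intro k*m∣ka-kb) =
  mod-intro (*-cancelˡ-∣ (+ k) (subst₂ _∣_ (ℤ.pos-* k m) (identity (+ k) a b) k*m∣ka-kb))
  where
  identity : ∀ k a b → k * a - k * b ≡ k * (a - b)
  identity = solve-∀

scale-∣ : ∀ {k n} → + k ∣ a → b ≡ a * + n → + (k ℕ.* n) ∣ b
scale-∣ {k = k} {n} k∣a b≡an = subst₂ _∣_ (sym (ℤ.pos-* k n)) (sym b≡an) (*-monoˡ-∣ (+ n) k∣a)

infix 4 _∤_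
_∤_ : ℤ → ℤ → Set
a ∤ b = ¬ a ∣ b

module _ {p : ℕ} (p-prime : Prime p) where

  prime>1 : 1 < p
  prime>1 = ℕ.nonTrivial⇒n>1 p {{prime⇒nonTrivial p-prime}}

  p∸1≢0 : NonZero (p ∸ 1)
  p∸1≢0 = ℕ.>-nonZero (ℕ.m<n⇒0<n∸m prime>1)

  ∣*⇒∣⊎∣ : + p ∣ a * b → + p ∣ a ⊎ + p ∣ b
  ∣*⇒∣⊎∣ {a = a} {b = b} p∣ab
    with euclidsLemma ℤ.∣ a ∣ ℤ.∣ b ∣ p-prime (subst (p ℕ.∣_) (ℤ.abs-* a b) (∣⇒∣ᵤ p∣ab))
  ... | inj₁ p∣a = inj₁ (∣ᵤ⇒∣ p∣a)
  ... | inj₂ p∣b = inj₂ (∣ᵤ⇒∣ p∣b)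

  ∤-* : + p ∤ a → + p ∤ b → + p ∤ a * b
  ∤-* p∤a p∤b p∣ab with ∣*⇒∣⊎∣ p∣ab
  ... | inj₁ p∣a = p∤a p∣a
  ... | inj₂ p∣b = p∤b p∣b

  prime∤1 : + p ∤ 1ℤ
  prime∤1 p∣1 = ℕ.<⇒≱ prime>1 (ℕ.∣⇒≤ (∣⇒∣ᵤ p∣1))

  ∤-^ : + p ∤ a → ∀ n → + p ∤ a ^ n
  ∤-^ p∤a zero    = prime∤1
  ∤-^ p∤a (suc n) = ∤-* p∤a (∤-^ p∤a n)

  ∤-cancelˡ : + p ∤ c → + p ∣ c * a → + p ∣ a
  ∤-cancelˡ p∤c p∣ca with ∣*⇒∣⊎∣ p∣ca
  ... | inj₁ p∣c = contradiction p∣c p∤c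
  ... | inj₂ p∣a = p∣a

  *-cancelˡ-≈ : + p ∤ c → c * a ≈ c * b [mod p ] → a ≈ b [mod p ]
  *-cancelˡ-≈ {c = c} {a = a} {b = b} p∤c (mod-intro p∣ca-cb) =
    mod-intro (∤-cancelˡ p∤c (∣-≡ (identity c a b) p∣ca-cb))
    where
    identity : ∀ c a b → c * a - c * b ≡ c * (a - b)
    identity = solve-∀

  ∤-small : 0 < n → n < p → + p ∤ + n
  ∤-small {n = suc _} _ n<p p∣n = ℕ.>⇒∤ n<p (∣⇒∣ᵤ p∣n)

  ∤⇒coprime : ∀ {i} → ¬ p ℕ.∣ i → Coprime i p
  ∤⇒coprime p∤i (d∣i , d∣p) with prime⇒irreducible p-prime d∣p
  ... | inj₁ d≡1 = d≡1
  ... | inj₂ refl = contradiction d∣i p∤i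

sumFin≡sum : ∀ n (h : Fin n → ℤ) → sumFin n h ≡ sum h
sumFin≡sum zero    h = refl
sumFin≡sum (suc n) h = cong (_+_ (h zero)) (sumFin≡sum n (h ∘ suc))

sum-cong-≈ : {f g : Fin n → ℤ} → (∀ j → f j ≈ g j [mod m ]) → sum f ≈ sum g [mod m ]
sum-cong-≈ {n = zero}  f≈g = ≈-refl
sum-cong-≈ {n = suc n} f≈g = +-cong-≈ (f≈g zero) (sum-cong-≈ (f≈g ∘ suc))

∑-distrib-- : ∀ (f g : Fin n → ℤ) → sum (λ j → f j - g j) ≡ sum f - sum g
∑-distrib-- {zero}  f g = refl
∑-distrib-- {suc n} f g = begin
  f₀ - g₀ + sum (λ j → f (suc j) - g (suc j)) ≡⟨ cong (_+_ (f₀ - g₀)) (∑-distrib-- (f ∘ suc) (g ∘ suc)) ⟩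
  f₀ - g₀ + (sum (f ∘ suc) - sum (g ∘ suc))    ≡⟨ identity f₀ g₀ (sum (f ∘ suc)) (sum (g ∘ suc)) ⟩
  f₀ + sum (f ∘ suc) - (g₀ + sum (g ∘ suc))    ∎
  where
  open ≡-Reasoning
  f₀ = f zero
  g₀ = g zero
  identity : ∀ a b c d → a - b + (c - d) ≡ a + c - (b + d)
  identity = solve-∀

sum-single : ∀ (f : Fin n → ℤ) i → (∀ j → j ≢ i → f j ≡ 0ℤ) → sum f ≡ f i
sum-single {suc n} f i off-i≡0 = begin
  sum f                                   ≡⟨ sum-remove f ⟩
  f i + sum (λ j → f (Fin.punchIn i j))   ≡⟨ cong (_+_ (f i)) (sum-cong-≗ (λ j → off-i≡0 _ (Fin.punchInᵢ≢i i j))) ⟩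
  f i + sum {n} (λ _ → 0ℤ)                ≡⟨ cong (_+_ (f i)) (sum-replicate-zero n) ⟩
  f i + 0ℤ                                ≡⟨ ℤ.+-identityʳ (f i) ⟩
  f i                                     ∎
  where open ≡-Reasoning

sum-reindex : ∀ {n m} (σ : Fin n ⤖ Fin m) (h : Fin m → ℤ) → sum h ≡ sum (h ∘ Bijection.to σ)
sum-reindex σ h = sum-permute h (⤖⇒↔ σ)

∣-sum : ∀ (f : Fin n → ℤ) → (∀ j → + m ∣ f j) → + m ∣ sum f
∣-sum {zero}  f m∣f = divides 0ℤ refl
∣-sum {suc n} f m∣f = ∣m∣n⇒∣m+n (m∣f zero) (∣-sum (f ∘ suc) (m∣f ∘ suc))

sum-ends : ∀ (h : Fin (suc (suc n)) → ℤ) → (∀ k → + m ∣ h (suc (Fin.inject₁ k))) →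
           sum h ≈ h zero + h (Fin.fromℕ (suc n)) [mod m ]
sum-ends {n} {m} h m∣inner = begin
  h zero + sum (h ∘ suc)                ≡⟨ cong (_+_ (h zero)) (sum-init-last (h ∘ suc)) ⟩
  h zero + (sum inner + h last)         ≈⟨ +-congˡ-≈ (h zero) (+-congʳ-≈ (h last) (∣⇒≈0 (∣-sum inner m∣inner))) ⟩
  h zero + (0ℤ + h last)                ≡⟨ cong (_+_ (h zero)) (ℤ.+-identityˡ (h last)) ⟩
  h zero + h last                       ∎
  where
  open ≈-Reasoning m
  inner = h ∘ suc ∘ Fin.inject₁
  last = Fin.fromℕ (suc n)

-- Fermat's little theorem

×ₘ≡* : ∀ n x → n ×ₘ x ≡ + n * x
×ₘ≡* zero    x = sym (ℤ.*-zeroˡ x)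
×ₘ≡* (suc n) x = begin
  x + n ×ₘ x     ≡⟨ cong (_+_ x) (×ₘ≡* n x) ⟩
  x + + n * x    ≡⟨ cong (_+ + n * x) (sym (ℤ.*-identityˡ x)) ⟩
  1ℤ * x + + n * x ≡⟨ sym (ℤ.*-distribʳ-+ x 1ℤ (+ n)) ⟩
  + suc n * x    ∎
  where open ≡-Reasoning

^ₛ≡^ : ∀ x n → x ^ₛ n ≡ x ^ n
^ₛ≡^ x zero    = refl
^ₛ≡^ x (suc n) = cong (x *_) (^ₛ≡^ x n)

module _ {p : ℕ} (p-prime : Prime p) where

  private
    instance
      p≢0 : NonZero p
      p≢0 = prime⇒nonZero p-prime

  p≡1+[p∸1] : p ≡ suc (p ∸ 1)
  p≡1+[p∸1] = sym (ℕ.suc-pred p)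

  p∸1<p : p ∸ 1 < p
  p∸1<p = subst (p ∸ 1 <_) (sym p≡1+[p∸1]) (ℕ.n<1+n (p ∸ 1))

  prime∤m! : m < p → ¬ p ℕ.∣ m ℕ.!
  prime∤m! {zero}  _   p∣1  = prime∤1 p-prime (∣ᵤ⇒∣ p∣1)
  prime∤m! {suc m} m<p p∣m! with euclidsLemma (suc m) (m ℕ.!) p-prime p∣m!
  ... | inj₁ p∣1+m = ℕ.>⇒∤ m<p p∣1+m
  ... | inj₂ p∣m!  = prime∤m! (ℕ.<-trans (ℕ.n<1+n m) m<p) p∣m!

  p!≡pCk*k!*[p∸k]! : k ≤ p → p ℕ.! ≡ (p choose k) ℕ.* (k ℕ.! ℕ.* (p ∸ k) ℕ.!)
  p!≡pCk*k!*[p∸k]! {k} k≤p = sym (trans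
    (cong (ℕ._* (k ℕ.! ℕ.* (p ∸ k) ℕ.!)) (nCk≡n!/k![n-k]! k≤p))
    (m/n*n≡m {{ℕ._!*_!≢0 k (p ∸ k)}} (k![n∸k]!∣n! k≤p)))

  prime∣p! : p ℕ.∣ p ℕ.!
  prime∣p! = subst (λ n → p ℕ.∣ n ℕ.!) (sym p≡1+[p∸1]) (ℕ.∣m⇒∣m*n _ (ℕ.∣-reflexive p≡1+[p∸1]))

  prime∣pCk : 0 < k → k < p → p ℕ.∣ p choose k
  prime∣pCk {k} 0<k k<p
    with euclidsLemma (p choose k) _ p-prime (subst (p ℕ.∣_) (p!≡pCk*k!*[p∸k]! (ℕ.<⇒≤ k<p)) prime∣p!)
  ... | inj₁ p∣C = p∣C
  ... | inj₂ p∣k![p-k]! with euclidsLemma (k ℕ.!) ((p ∸ k) ℕ.!) p-prime p∣k![p-k]!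
  ...   | inj₁ p∣k!     = contradiction p∣k! (prime∤m! k<p)
  ...   | inj₂ p∣[p-k]! = contradiction p∣[p-k]! (prime∤m! (ℕ.∸-monoʳ-< 0<k (ℕ.<⇒≤ k<p)))

  binomial-mod-prime : ∀ x y → (x + y) ^ p ≈ x ^ p + y ^ p [mod p ]
  binomial-mod-prime x y = subst (λ q → (x + y) ^ q ≈ x ^ q + y ^ q [mod p ]) (sym p≡1+[p∸1])
                             (expansion (p ∸ 1) (sym p≡1+[p∸1]))
    where
    term : ∀ n k → binomialTerm x y n k ≡ + (n choose Fin.toℕ k) * (x ^ Fin.toℕ k * y ^ (n ∸ Fin.toℕ k))
    term n k = trans (×ₘ≡* (n choose Fin.toℕ k) _)
      (cong (+ (n choose Fin.toℕ k) *_) (cong₂ _*_ (^ₛ≡^ x (Fin.toℕ k)) (^ₛ≡^ y (n ∸ Fin.toℕ k))))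

    first : ∀ n → binomialTerm x y n zero ≡ y ^ n
    first n = trans (term n zero) (trans (ℤ.*-identityˡ (1ℤ * y ^ n)) (ℤ.*-identityˡ (y ^ n)))

    last : ∀ n → binomialTerm x y n (Fin.fromℕ n) ≡ x ^ n
    last n = begin
      binomialTerm x y n (Fin.fromℕ n)                   ≡⟨ term n (Fin.fromℕ n) ⟩
      + (n choose toℕn) * (x ^ toℕn * y ^ (n ∸ toℕn))
        ≡⟨ cong (λ k → + (n choose k) * (x ^ k * y ^ (n ∸ k))) (Fin.toℕ-fromℕ n) ⟩
      + (n choose n) * (x ^ n * y ^ (n ∸ n))
        ≡⟨ cong₂ (λ c k → + c * (x ^ n * y ^ k)) (nCn≡1 n) (ℕ.n∸n≡0 n) ⟩
      1ℤ * (x ^ n * 1ℤ)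
        ≡⟨ trans (ℤ.*-identityˡ (x ^ n * 1ℤ)) (ℤ.*-identityʳ (x ^ n)) ⟩
      x ^ n                                              ∎
      where
      open ≡-Reasoning
      toℕn = Fin.toℕ (Fin.fromℕ n)

    expansion : ∀ n → suc n ≡ p → (x + y) ^ suc n ≈ x ^ suc n + y ^ suc n [mod p ]
    expansion n refl = begin
      (x + y) ^ suc n                                                   ≡⟨ sym (^ₛ≡^ (x + y) (suc n)) ⟩
      (x + y) ^ₛ suc n                                                  ≡⟨ binomial-theorem (suc n) x y ⟩
      sum (binomialTerm x y (suc n))                                    ≈⟨ sum-ends (binomialTerm x y (suc n)) inner ⟩
      binomialTerm x y (suc n) zero + binomialTerm x y (suc n) (Fin.fromℕ (suc n)) ≡⟨ cong₂ _+_ (first (suc n)) (last (suc n)) ⟩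
      y ^ suc n + x ^ suc n                                             ≡⟨ ℤ.+-comm (y ^ suc n) (x ^ suc n) ⟩
      x ^ suc n + y ^ suc n                                             ∎
      where
      open ≈-Reasoning (suc n)
      inner : ∀ k → + suc n ∣ binomialTerm x y (suc n) (suc (Fin.inject₁ k))
      inner k = ∣-≡ (sym (term (suc n) (suc k′))) (∣m⇒∣m*n {m = + (suc n choose suc (Fin.toℕ k′))} _ (∣ᵤ⇒∣ p∣C))
        where
        k′ = Fin.inject₁ k
        p∣C : suc n ℕ.∣ suc n choose suc (Fin.toℕ k′)
        p∣C = prime∣pCk (ℕ.s≤s ℕ.z≤n) (ℕ.s≤s (subst (ℕ._< n) (sym (Fin.toℕ-inject₁ k)) (Fin.toℕ<n k)))

  0^p≡0 : 0ℤ ^ p ≡ 0ℤ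
  0^p≡0 = cong (0ℤ ^_) p≡1+[p∸1]

  fermat-ℕ : ∀ n → (+ n) ^ p ≈ + n [mod p ]
  fermat-ℕ zero    = ≈-reflexive 0^p≡0
  fermat-ℕ (suc n) = begin
    (1ℤ + + n) ^ p      ≈⟨ binomial-mod-prime 1ℤ (+ n) ⟩
    1ℤ ^ p + (+ n) ^ p  ≈⟨ +-cong-≈ (≈-reflexive (ℤ.^-zeroˡ p)) (fermat-ℕ n) ⟩
    1ℤ + + n            ∎
    where open ≈-Reasoning p

  fermat : ∀ x → x ^ p ≈ x [mod p ]
  fermat (+ n)      = fermat-ℕ n
  -- (u + - u) ^ p ≡ u ^ p + (- u) ^ p gives the negative case without using the parity of p.
  fermat ℤ.-[1+ n ] = begin
    (- u) ^ p                   ≡⟨ identity (u ^ p) ((- u) ^ p) ⟩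
    (u ^ p + (- u) ^ p) - u ^ p ≈⟨ +-congʳ-≈ (- u ^ p) (≈-sym (binomial-mod-prime u (- u))) ⟩
    (u + - u) ^ p - u ^ p       ≡⟨ cong (λ z → z ^ p - u ^ p) (ℤ.+-inverseʳ u) ⟩
    0ℤ ^ p - u ^ p              ≡⟨ cong (_- u ^ p) 0^p≡0 ⟩
    0ℤ - u ^ p                  ≈⟨ +-congˡ-≈ 0ℤ (neg-cong-≈ (fermat-ℕ (suc n))) ⟩
    0ℤ - u                      ≡⟨ ℤ.+-identityˡ (- u) ⟩
    - u                         ∎
    where
    open ≈-Reasoning p
    u = + suc n
    identity : ∀ x y → y ≡ (x + y) - x
    identity = solve-∀

  fermat-unit : + p ∤ x → x ^ (p ∸ 1) ≈ 1ℤ [mod p ]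
  fermat-unit {x = x} p∤x = *-cancelˡ-≈ p-prime p∤x (begin
    x * x ^ (p ∸ 1)    ≡⟨ cong (x ^_) (sym p≡1+[p∸1]) ⟩
    x ^ p              ≈⟨ fermat x ⟩
    x                  ≡⟨ sym (ℤ.*-identityʳ x) ⟩
    x * 1ℤ             ∎)
    where open ≈-Reasoning p

-- Exponents modulo n

-- α ≡ β (mod n) on ℕ, in the shape that splits x ^ α as x ^ base * (x ^ n) ^ u.
record CommonBase (n α β : ℕ) : Set where
  constructor common-base
  field
    base u v : ℕ
    α≡ : α ≡ base ℕ.+ u ℕ.* n
    β≡ : β ≡ base ℕ.+ v ℕ.* n

CommonBase-sym : ∀ {n α β} → CommonBase n α β → CommonBase n β α
CommonBase-sym (common-base r u v α≡ β≡) = common-base r v u β≡ α≡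

∣+m-+n∣≡∣m-n∣ : ∀ m n → ℤ.∣ + m - + n ∣ ≡ ℕ.∣ m - n ∣
∣+m-+n∣≡∣m-n∣ m n with ℕ.≤-total m n
... | inj₁ m≤n = begin
  ℤ.∣ + m - + n ∣       ≡⟨ cong ℤ.∣_∣ (trans (ℤ.m-n≡m⊖n m n) (ℤ.⊖-≤ m≤n)) ⟩
  ℤ.∣ - + (n ∸ m) ∣     ≡⟨ ℤ.∣-i∣≡∣i∣ (+ (n ∸ m)) ⟩
  n ∸ m                 ≡⟨ ℕ.m≤n⇒∣m-n∣≡n∸m m≤n ⟨
  ℕ.∣ m - n ∣           ∎
  where open ≡-Reasoning
... | inj₂ n≤m = trans (cong ℤ.∣_∣ (trans (ℤ.m-n≡m⊖n m n) (ℤ.⊖-≥ n≤m))) (sym (ℕ.m≤n⇒∣n-m∣≡n∸m n≤m))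

private
  ≤⇒CommonBase : ∀ {n α β} → α ≤ β → + n ∣ + α - + β → CommonBase n α β
  ≤⇒CommonBase {n} {α} {β} α≤β n∣α-β with ∣⇒∣ᵤ n∣α-β
  ... | ℕ.divides v eq = common-base α 0 v (sym (ℕ.+-identityʳ α)) (begin
    β                   ≡⟨ ℕ.m+[n∸m]≡n α≤β ⟨
    α ℕ.+ (β ∸ α)       ≡⟨ cong (α ℕ.+_) β-α≡ ⟩
    α ℕ.+ v ℕ.* n       ∎)
    where
    open ≡-Reasoning
    β-α≡ : β ∸ α ≡ v ℕ.* n
    β-α≡ = begin
      β ∸ α               ≡⟨ ℕ.m≤n⇒∣m-n∣≡n∸m α≤β ⟨
      ℕ.∣ α - β ∣         ≡⟨ ∣+m-+n∣≡∣m-n∣ α β ⟨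
      ℤ.∣ + α - + β ∣      ≡⟨ eq ⟩
      v ℕ.* n             ∎

≈⇒CommonBase : ∀ {n α β} → + α ≈ + β [mod n ] → CommonBase n α β
≈⇒CommonBase {α = α} {β} (mod-intro n∣α-β) with ℕ.≤-total α β
... | inj₁ α≤β = ≤⇒CommonBase α≤β n∣α-β
... | inj₂ β≤α = CommonBase-sym (≤⇒CommonBase β≤α (∣-difference (≈-sym {a = + α} {b = + β} (mod-intro n∣α-β))))

CommonBase-difference : ∀ {n α β} (cb : CommonBase n α β) →
                        + α - + β ≡ (+ CommonBase.u cb - + CommonBase.v cb) * + n
CommonBase-difference {n} (common-base r u v refl refl) = begin
  + (r ℕ.+ u ℕ.* n) - + (r ℕ.+ v ℕ.* n)    ≡⟨ cong₂ _-_ (pos-+* r u) (pos-+* r v) ⟩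
  (+ r + + u * + n) - (+ r + + v * + n)    ≡⟨ identity (+ r) (+ u) (+ v) (+ n) ⟩
  (+ u - + v) * + n                        ∎
  where
  open ≡-Reasoning
  pos-+* : ∀ r u → + (r ℕ.+ u ℕ.* n) ≡ + r + + u * + n
  pos-+* r u = trans (ℤ.pos-+ r (u ℕ.* n)) (cong (_+_ (+ r)) (ℤ.pos-* u n))
  identity : ∀ r u v n → (r + u * n) - (r + v * n) ≡ (u - v) * n
  identity = solve-∀

CommonBase⇒≈ : ∀ {n α β} → CommonBase n α β → + α ≈ + β [mod n ]
CommonBase⇒≈ cb = mod-intro (divides (+ CommonBase.u cb - + CommonBase.v cb) (CommonBase-difference cb))

mod⇒≈ : ∀ {d α β} .{{_ : NonZero d}} → α mod d ≡ β mod d → + α ≈ + β [mod d ]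
mod⇒≈ {d} {α} {β} α≡β = CommonBase⇒≈ (common-base (Fin.toℕ (α mod d)) (α ℕ./ d) (β ℕ./ d)
  (DivMod.property (α divMod d)) (trans (DivMod.property (β divMod d)) (cong (λ r → Fin.toℕ r ℕ.+ _) (sym α≡β))))

^-+* : ∀ x r u n → x ^ (r ℕ.+ u ℕ.* n) ≡ x ^ r * (x ^ n) ^ u
^-+* x r u n = begin
  x ^ (r ℕ.+ u ℕ.* n)      ≡⟨ ℤ.^-distribˡ-+-* x r (u ℕ.* n) ⟩
  x ^ r * x ^ (u ℕ.* n)    ≡⟨ cong (λ e → x ^ r * x ^ e) (ℕ.*-comm u n) ⟩
  x ^ r * x ^ (n ℕ.* u)    ≡⟨ cong (x ^ r *_) (ℤ.^-*-assoc x n u) ⟨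
  x ^ r * (x ^ n) ^ u      ∎
  where open ≡-Reasoning

^-cong-exponent : ∀ {M n α β} → x ^ n ≈ 1ℤ [mod M ] → + α ≈ + β [mod n ] → x ^ α ≈ x ^ β [mod M ]
^-cong-exponent {x} {M} {n} xⁿ≈1 α≈β with ≈⇒CommonBase α≈β
... | common-base r u v refl refl = begin
  x ^ (r ℕ.+ u ℕ.* n)   ≡⟨ ^-+* x r u n ⟩
  x ^ r * (x ^ n) ^ u   ≈⟨ *-congˡ-≈ (x ^ r) (power-of-one u) ⟩
  x ^ r * 1ℤ            ≈⟨ *-congˡ-≈ (x ^ r) (≈-sym (power-of-one v)) ⟩
  x ^ r * (x ^ n) ^ v   ≡⟨ ^-+* x r v n ⟨
  x ^ (r ℕ.+ v ℕ.* n)   ∎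
  where
  open ≈-Reasoning M
  power-of-one : ∀ u → (x ^ n) ^ u ≈ 1ℤ [mod M ]
  power-of-one u = ≈-trans (^-cong-≈ u xⁿ≈1) (≈-reflexive (ℤ.^-zeroˡ u))

-- Polynomials with many roots modulo p

horner : (Fin n → ℤ) → ℤ → ℤ
horner {zero}  C x = 0ℤ
horner {suc n} C x = C zero + x * horner (C ∘ suc) x

horner≡sum : ∀ (C : Fin n → ℤ) x → horner C x ≡ sum (λ r → C r * x ^ Fin.toℕ r)
horner≡sum {zero}  C x = refl
horner≡sum {suc n} C x = cong₂ _+_ (sym (ℤ.*-identityʳ (C zero))) (begin
  x * horner (C ∘ suc) x                              ≡⟨ cong (x *_) (horner≡sum (C ∘ suc) x) ⟩
  x * sum (λ r → C (suc r) * x ^ Fin.toℕ r)           ≡⟨ *-distribˡ-sum x (λ r → C (suc r) * x ^ Fin.toℕ r) ⟩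
  sum (λ r → x * (C (suc r) * x ^ Fin.toℕ r))         ≡⟨ sum-cong-≗ (λ r → identity x (C (suc r)) (x ^ Fin.toℕ r)) ⟩
  sum (λ r → C (suc r) * (x * x ^ Fin.toℕ r))         ∎)
  where
  open ≡-Reasoning
  identity : ∀ x c y → x * (c * y) ≡ c * (x * y)
  identity = solve-∀

horner-quotient : (Fin (suc n) → ℤ) → ℤ → Fin n → ℤ
horner-quotient {suc n} C a zero    = horner (C ∘ suc) a
horner-quotient {suc n} C a (suc r) = horner-quotient (C ∘ suc) a r

horner-factor : ∀ (C : Fin (suc n) → ℤ) a x →
                horner C x - horner C a ≡ (x - a) * horner (horner-quotient C a) x
horner-factor {zero}  C a x = identity (C zero) a x
  where
  identity : ∀ c a x → (c + x * 0ℤ) - (c + a * 0ℤ) ≡ (x - a) * 0ℤ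
  identity = solve-∀
horner-factor {suc n} C a x = begin
  (C zero + x * H x) - (C zero + a * H a)   ≡⟨ identity (C zero) a x (H a) (H x) ⟩
  (x - a) * H a + x * (H x - H a)           ≡⟨ cong (λ z → (x - a) * H a + x * z) (horner-factor (C ∘ suc) a x) ⟩
  (x - a) * H a + x * ((x - a) * Q x)       ≡⟨ identity′ a x (H a) (Q x) ⟩
  (x - a) * (H a + x * Q x)                 ∎
  where
  open ≡-Reasoning
  H = horner (C ∘ suc)
  Q = horner (horner-quotient (C ∘ suc) a)
  identity : ∀ c a x ha hx → (c + x * hx) - (c + a * ha) ≡ (x - a) * ha + x * (hx - ha)
  identity = solve-∀
  identity′ : ∀ a x ha qx → (x - a) * ha + x * ((x - a) * qx) ≡ (x - a) * (ha + x * qx)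
  identity′ = solve-∀

∣-coefficients : ∀ (C : Fin (suc n) → ℤ) a → + m ∣ horner C a →
                 (∀ r → + m ∣ horner-quotient C a r) → ∀ r → + m ∣ C r
∣-coefficients {zero}  C a m∣Ca _ zero = ∣-≡ (identity (C zero) a) m∣Ca
  where
  identity : ∀ c a → c + a * 0ℤ ≡ c
  identity = solve-∀
∣-coefficients {suc n} C a m∣Ca m∣Q zero =
  ∣-≡ (identity (C zero) a (horner (C ∘ suc) a)) (∣m∣n⇒∣m+n m∣Ca (∣m⇒∣-m (∣n⇒∣m*n a (m∣Q zero))))
  where
  identity : ∀ c a h → (c + a * h) + - (a * h) ≡ c
  identity = solve-∀
∣-coefficients {suc n} C a m∣Ca m∣Q (suc r) = ∣-coefficients (C ∘ suc) a (m∣Q zero) (m∣Q ∘ suc) r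

horner-sub : ∀ (C C′ : Fin n → ℤ) x → horner (λ r → C r - C′ r) x ≡ horner C x - horner C′ x
horner-sub {zero}  C C′ x = refl
horner-sub {suc n} C C′ x = begin
  (C zero - C′ zero) + x * horner (λ r → C (suc r) - C′ (suc r)) x
    ≡⟨ cong (λ h → (C zero - C′ zero) + x * h) (horner-sub (C ∘ suc) (C′ ∘ suc) x) ⟩
  (C zero - C′ zero) + x * (horner (C ∘ suc) x - horner (C′ ∘ suc) x) ≡⟨ identity (C zero) (C′ zero) x _ _ ⟩
  (C zero + x * horner (C ∘ suc) x) - (C′ zero + x * horner (C′ ∘ suc) x) ∎
  where
  open ≡-Reasoning
  identity : ∀ c c′ x h h′ → (c - c′) + x * (h - h′) ≡ (c + x * h) - (c′ + x * h′)
  identity = solve-∀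

module _ {p : ℕ} (p-prime : Prime p) where

  roots⇒∣-coefficients : ∀ (C a : Fin n → ℤ) → (∀ u v → u ≢ v → + p ∤ a u - a v) →
                         (∀ u → + p ∣ horner C (a u)) → ∀ r → + p ∣ C r
  roots⇒∣-coefficients {suc n} C a distinct roots =
    ∣-coefficients C (a zero) (roots zero)
      (roots⇒∣-coefficients Q (a ∘ suc) (λ u v u≢v → distinct (suc u) (suc v) (u≢v ∘ Fin.suc-injective)) Q-roots)
    where
    Q = horner-quotient C (a zero)
    Q-roots : ∀ u → + p ∣ horner Q (a (suc u))
    Q-roots u = ∤-cancelˡ p-prime (distinct (suc u) zero (λ ()))
      (∣-≡ (horner-factor C (a zero) (a (suc u))) (∣m∣n⇒∣m+n (roots (suc u)) (∣m⇒∣-m (roots zero))))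

-- Sparse sums and residue classes of exponents

sparse : (Fin n → ℤ) → (Fin n → ℕ) → ℤ → ℤ
sparse c γ x = sum (λ j → c j * x ^ γ j)

eval≡sparse : ∀ h x → eval h x ≡ sparse (coeff h) (expo h) x
eval≡sparse h x = sumFin≡sum (t h) (λ j → coeff h j * x ^ expo h j)

sparse-cong-≈ : ∀ (c : Fin n → ℤ) γ → x ≈ y [mod m ] → sparse c γ x ≈ sparse c γ y [mod m ]
sparse-cong-≈ c γ x≈y = sum-cong-≈ (λ j → *-congˡ-≈ (c j) (^-cong-≈ (γ j) x≈y))

select : ∀ {d} → Fin d → Fin d → ℤ → ℤ
select r s c = if does (r Fin.≟ s) then c else 0ℤ

select-≡ : ∀ {d} (r : Fin d) c → select r r c ≡ c
select-≡ r c with r Fin.≟ r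
... | yes _   = refl
... | no r≢r = contradiction refl r≢r

select-≢ : ∀ {d} {r s : Fin d} c → r ≢ s → select r s c ≡ 0ℤ
select-≢ {r = r} {s} c r≢s with r Fin.≟ s
... | yes r≡s = contradiction r≡s r≢s
... | no _    = refl

residue-coeff : (d : ℕ) .{{_ : NonZero d}} → (Fin n → ℤ) → (Fin n → ℕ) → Fin d → ℤ
residue-coeff d c γ r = sum (λ j → select (γ j mod d) r (c j))

module _ (d : ℕ) .{{_ : NonZero d}} {n} (c : Fin n → ℤ) (γ : Fin n → ℕ) where

  residue-coeff-at : (∀ j l → γ j mod d ≡ γ l mod d → j ≡ l) → ∀ j → residue-coeff d c γ (γ j mod d) ≡ c j
  residue-coeff-at injective j =
    trans (sum-single _ j (λ l l≢j → select-≢ (c l) (l≢j ∘ injective l j))) (select-≡ (γ j mod d) (c j))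

  residue-coeff-empty : ∀ r → (∀ j → γ j mod d ≢ r) → residue-coeff d c γ r ≡ 0ℤ
  residue-coeff-empty r not-r = trans (sum-cong-≗ (λ j → select-≢ (c j) (not-r j))) (sum-replicate-zero n)

  sparse≈horner-residue-coeff : ∀ {M x} → x ^ d ≈ 1ℤ [mod M ] →
                                sparse c γ x ≈ horner (residue-coeff d c γ) x [mod M ]
  sparse≈horner-residue-coeff {M} {x} xᵈ≈1 = begin
    sum (λ j → c j * x ^ γ j)
      ≈⟨ sum-cong-≈ (λ j → *-congˡ-≈ (c j) (^-cong-exponent xᵈ≈1 (reduce j))) ⟩
    sum (λ j → c j * x ^ Fin.toℕ (γ j mod d))              ≡⟨ sum-cong-≗ (λ j → sym (spread j)) ⟩
    sum (λ j → sum (λ r → term j r * x ^ Fin.toℕ r))       ≡⟨ ∑-comm (λ j r → term j r * x ^ Fin.toℕ r) ⟩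
    sum (λ r → sum (λ j → term j r * x ^ Fin.toℕ r))
      ≡⟨ sum-cong-≗ (λ r → sym (*-distribʳ-sum (x ^ Fin.toℕ r) (λ j → term j r))) ⟩
    sum (λ r → residue-coeff d c γ r * x ^ Fin.toℕ r)      ≡⟨ horner≡sum (residue-coeff d c γ) x ⟨
    horner (residue-coeff d c γ) x                         ∎
    where
    open ≈-Reasoning M
    term : Fin n → Fin d → ℤ
    term j r = select (γ j mod d) r (c j)
    reduce : ∀ j → + γ j ≈ + Fin.toℕ (γ j mod d) [mod d ]
    reduce j = CommonBase⇒≈ (common-base (Fin.toℕ (γ j mod d)) (γ j ℕ./ d) 0
      (DivMod.property (γ j divMod d)) (sym (ℕ.+-identityʳ _)))
    spread : ∀ j → sum (λ r → term j r * x ^ Fin.toℕ r) ≡ c j * x ^ Fin.toℕ (γ j mod d)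
    spread j = trans (sum-single _ (γ j mod d) off)
                     (cong (_* x ^ Fin.toℕ (γ j mod d)) (select-≡ (γ j mod d) (c j)))
      where
      off : ∀ r → r ≢ γ j mod d → term j r * x ^ Fin.toℕ r ≡ 0ℤ
      off r r≢ = cong (_* x ^ Fin.toℕ r) (select-≢ (c j) (r≢ ∘ sym))

module _ {p : ℕ} (p-prime : Prime p) where

  private
    instance
      p∸1-nonZero : NonZero (p ∸ 1)
      p∸1-nonZero = p∸1≢0 p-prime

  ∣-difference⇒≡ : m < p → n < p → + p ∣ + m - + n → m ≡ n
  ∣-difference⇒≡ {m} {n} m<p n<p p∣m-n
    with ℕ.∣ m - n ∣ in eq | subst (p ℕ.∣_) (∣+m-+n∣≡∣m-n∣ m n) (∣⇒∣ᵤ p∣m-n)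
  ... | zero  | _       = ℕ.∣m-n∣≡0⇒m≡n eq
  ... | suc k | p∣1+k   = contradiction p∣1+k (ℕ.>⇒∤ (subst (_< p) eq
          (ℕ.≤-<-trans (ℕ.∣m-n∣≤m⊔n m n) (ℕ.⊔-lub m<p n<p))))

  agree⇒residue-coeff≈ : ∀ {n₁ n₂} (a : Fin n₁ → ℤ) α (b : Fin n₂ → ℤ) β →
    (∀ i → 1 ≤ i → i ≤ p ∸ 1 → sparse a α (+ i) ≈ sparse b β (+ i) [mod p ]) →
    ∀ r → residue-coeff (p ∸ 1) a α r ≈ residue-coeff (p ∸ 1) b β r [mod p ]
  agree⇒residue-coeff≈ a α b β agree r = mod-intro (roots⇒∣-coefficients p-prime difference point points-distinct root r)
    where
    difference : Fin (p ∸ 1) → ℤ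
    difference r = residue-coeff (p ∸ 1) a α r - residue-coeff (p ∸ 1) b β r
    point : Fin (p ∸ 1) → ℤ
    point u = + suc (Fin.toℕ u)
    point<p : ∀ u → suc (Fin.toℕ u) < p
    point<p u = subst (suc (suc (Fin.toℕ u)) ≤_) (sym (p≡1+[p∸1] p-prime)) (ℕ.s≤s (Fin.toℕ<n u))
    points-distinct : ∀ u v → u ≢ v → + p ∤ point u - point v
    points-distinct u v u≢v = u≢v ∘ Fin.toℕ-injective ∘ ℕ.suc-injective ∘ ∣-difference⇒≡ (point<p u) (point<p v)
    root : ∀ u → + p ∣ horner difference (point u)
    root u = ≈0⇒∣ (begin
      horner difference z
        ≡⟨ horner-sub (residue-coeff (p ∸ 1) a α) (residue-coeff (p ∸ 1) b β) z ⟩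
      horner (residue-coeff (p ∸ 1) a α) z - horner (residue-coeff (p ∸ 1) b β) z
        ≈⟨ +-cong-≈ (≈-sym (sparse≈horner-residue-coeff (p ∸ 1) a α zᵖ⁻¹≈1))
                    (neg-cong-≈ (≈-sym (sparse≈horner-residue-coeff (p ∸ 1) b β zᵖ⁻¹≈1))) ⟩
      sparse a α z - sparse b β z
        ≈⟨ +-congʳ-≈ (- sparse b β z) (agree (suc (Fin.toℕ u)) (ℕ.s≤s ℕ.z≤n) (Fin.toℕ<n u)) ⟩
      sparse b β z - sparse b β z                           ≡⟨ ℤ.+-inverseʳ (sparse b β z) ⟩
      0ℤ                                                    ∎)
      where
      open ≈-Reasoning p
      z = point u
      zᵖ⁻¹≈1 : z ^ (p ∸ 1) ≈ 1ℤ [mod p ]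
      zᵖ⁻¹≈1 = fermat-unit p-prime (∤-small p-prime (ℕ.s≤s ℕ.z≤n) (point<p u))

  vanish⇒∣-coefficients : ∀ (c : Fin n → ℤ) γ → (∀ j l → + γ j ≈ + γ l [mod p ∸ 1 ] → j ≡ l) →
    (∀ i → 1 ≤ i → i ≤ p ∸ 1 → + p ∣ sparse c γ (+ i)) → ∀ j → + p ∣ c j
  vanish⇒∣-coefficients c γ injective vanish j = ≈0⇒∣ (begin
    c j                                   ≡⟨ residue-coeff-at (p ∸ 1) c γ (λ j l → injective j l ∘ mod⇒≈) j ⟨
    residue-coeff (p ∸ 1) c γ (γ j mod (p ∸ 1))
      ≈⟨ agree⇒residue-coeff≈ {n₂ = 0} c γ (λ ()) (λ ()) (λ i 1≤i i<p → ∣⇒≈0 (vanish i 1≤i i<p)) (γ j mod (p ∸ 1)) ⟩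
    0ℤ                                    ∎)
    where open ≈-Reasoning p

  residue-partner : ∀ {n₁ n₂} (a : Fin n₁ → ℤ) α (b : Fin n₂ → ℤ) β →
    (∀ r → residue-coeff (p ∸ 1) a α r ≈ residue-coeff (p ∸ 1) b β r [mod p ]) →
    (∀ j l → α j mod (p ∸ 1) ≡ α l mod (p ∸ 1) → j ≡ l) →
    ∀ j → + p ∤ a j → Σ[ l ∈ Fin n₂ ] β l mod (p ∸ 1) ≡ α j mod (p ∸ 1)
  residue-partner a α b β same-residues injective j p∤aj
    with Fin.any? (λ l → β l mod (p ∸ 1) Fin.≟ α j mod (p ∸ 1))
  ... | yes partner = partner
  ... | no none = contradiction (≈0⇒∣ (begin
    a j                                     ≡⟨ residue-coeff-at (p ∸ 1) a α injective j ⟨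
    residue-coeff (p ∸ 1) a α (α j mod (p ∸ 1)) ≈⟨ same-residues (α j mod (p ∸ 1)) ⟩
    residue-coeff (p ∸ 1) b β (α j mod (p ∸ 1)) ≡⟨ residue-coeff-empty (p ∸ 1) b β _ (λ l same → none (l , same)) ⟩
    0ℤ                                      ∎)) p∤aj
    where open ≈-Reasoning p

-- Binomial expansions

binomial-linear-≈ : ∀ x y → + m ∣ y * y → ∀ n → (x + y) ^ suc n ≈ x ^ suc n + + suc n * (x ^ n * y) [mod m ]
binomial-linear-≈ x y _ zero = ≈-reflexive (identity x y)
  where
  identity : ∀ x y → (x + y) * 1ℤ ≡ x * 1ℤ + + 1 * (1ℤ * y)
  identity = solve-∀
binomial-linear-≈ {m = m} x y m∣y² (suc n) = begin
  (x + y) * (x + y) ^ suc n                                     ≈⟨ *-congˡ-≈ (x + y) (binomial-linear-≈ x y m∣y² n) ⟩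
  (x + y) * (x ^ suc n + + suc n * (x ^ n * y))                 ≡⟨ identity x y (x ^ n) (+ suc n) ⟩
  x ^ suc (suc n) + (1ℤ + + suc n) * (x ^ suc n * y) + + suc n * x ^ n * (y * y)
    ≈⟨ +-congˡ-≈ (x ^ suc (suc n) + (1ℤ + + suc n) * (x ^ suc n * y)) (∣⇒≈0 (∣n⇒∣m*n (+ suc n * x ^ n) m∣y²)) ⟩
  x ^ suc (suc n) + (1ℤ + + suc n) * (x ^ suc n * y) + 0ℤ       ≡⟨ ℤ.+-identityʳ _ ⟩
  x ^ suc (suc n) + + suc (suc n) * (x ^ suc n * y)             ∎
  where
  open ≈-Reasoning m
  identity : ∀ x y X N → (x + y) * (x * X + N * (X * y)) ≡ x * (x * X) + (1ℤ + N) * ((x * X) * y) + N * X * (y * y)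
  identity = solve-∀

pow-linear-≈ : ∀ y → + m ∣ y * y → ∀ n → (1ℤ + y) ^ n ≈ 1ℤ + + n * y [mod m ]
pow-linear-≈ y _ zero = ≈-reflexive (identity y)
  where
  identity : ∀ y → 1ℤ ≡ 1ℤ + 0ℤ * y
  identity = solve-∀
pow-linear-≈ {m = m} y m∣y² (suc n) = begin
  (1ℤ + y) ^ suc n                               ≈⟨ binomial-linear-≈ 1ℤ y m∣y² n ⟩
  1ℤ ^ suc n + + suc n * (1ℤ ^ n * y)
    ≡⟨ cong₂ (λ a b → a + + suc n * (b * y)) (ℤ.^-zeroˡ (suc n)) (ℤ.^-zeroˡ n) ⟩
  1ℤ + + suc n * (1ℤ * y)                        ≡⟨ cong (λ z → 1ℤ + + suc n * z) (ℤ.*-identityˡ y) ⟩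
  1ℤ + + suc n * y                               ∎
  where open ≈-Reasoning m

-- Modulo M ∣ q², (1 + q A) ^ u ≡ 1 + u q A, so a term of f - g is linear in A.
term-expansion : ∀ {M q n} a b e x A r u v → + M ∣ + q * + q → a - b ≡ e * + q → x ^ n ≈ 1ℤ + + q * A [mod M ] →
  a * x ^ (r ℕ.+ u ℕ.* n) - b * x ^ (r ℕ.+ v ℕ.* n) ≈ + q * (e * x ^ r + A * (a * (+ u - + v) * x ^ r)) [mod M ]
term-expansion {M} {q} {n} a b e x A r u v M∣q² a-b≡eq xⁿ≈1+qA = begin
  a * x ^ (r ℕ.+ u ℕ.* n) - b * x ^ (r ℕ.+ v ℕ.* n)
    ≡⟨ cong₂ (λ y z → a * y - b * z) (^-+* x r u n) (^-+* x r v n) ⟩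
  a * (X * (x ^ n) ^ u) - b * (X * (x ^ n) ^ v)
    ≈⟨ +-cong-≈ (*-congˡ-≈ a (*-congˡ-≈ X (first-order u))) (neg-cong-≈ (*-congˡ-≈ b (*-congˡ-≈ X (first-order v)))) ⟩
  a * (X * (1ℤ + + u * (Q * A))) - b * (X * (1ℤ + + v * (Q * A)))
    ≡⟨ cong (λ b → a * (X * (1ℤ + + u * (Q * A))) - b * (X * (1ℤ + + v * (Q * A)))) b≡a-eq ⟩
  a * (X * (1ℤ + + u * (Q * A))) - (a - e * Q) * (X * (1ℤ + + v * (Q * A)))
    ≡⟨ identity a e Q X A (+ u) (+ v) ⟩
  Q * (e * X + A * (a * (+ u - + v) * X)) + Q * Q * (X * A * e * + v)
    ≈⟨ +-congˡ-≈ (Q * (e * X + A * (a * (+ u - + v) * X))) (∣⇒≈0 (∣m⇒∣m*n _ M∣q²)) ⟩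
  Q * (e * X + A * (a * (+ u - + v) * X)) + 0ℤ
    ≡⟨ ℤ.+-identityʳ _ ⟩
  Q * (e * X + A * (a * (+ u - + v) * X)) ∎
  where
  open ≈-Reasoning M
  Q = + q
  X = x ^ r
  first-order : ∀ u → (x ^ n) ^ u ≈ 1ℤ + + u * (Q * A) [mod M ]
  first-order u = ≈-trans (^-cong-≈ u xⁿ≈1+qA)
    (pow-linear-≈ (Q * A) (∣-≡ (identity′ Q A) (∣m⇒∣m*n (A * A) M∣q²)) u)
    where
    identity′ : ∀ Q A → Q * Q * (A * A) ≡ Q * A * (Q * A)
    identity′ = solve-∀
  b≡a-eq : b ≡ a - e * Q
  b≡a-eq = trans (identity″ a b) (cong (_-_ a) a-b≡eq)
    where
    identity″ : ∀ a b → b ≡ a - (a - b)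
    identity″ = solve-∀
  identity : ∀ a e Q X A U V →
    a * (X * (1ℤ + U * (Q * A))) - (a - e * Q) * (X * (1ℤ + V * (Q * A)))
    ≡ Q * (e * X + A * (a * (U - V) * X)) + Q * Q * (X * A * e * V)
  identity = solve-∀

binomial-cubic : ∀ n y → ∃ λ s → (1ℤ + y) ^ n ≡ 1ℤ + + n * y + + (n choose 2) * (y * y) + y * y * y * s
binomial-cubic zero    y = 0ℤ , identity y
  where
  identity : ∀ y → 1ℤ ≡ 1ℤ + 0ℤ * y + 0ℤ * (y * y) + y * y * y * 0ℤ
  identity = solve-∀
binomial-cubic (suc n) y with binomial-cubic n y
... | s , eq = s + + (n choose 2) + y * s , (begin
  (1ℤ + y) * (1ℤ + y) ^ n                                                      ≡⟨ cong ((1ℤ + y) *_) eq ⟩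
  (1ℤ + y) * (1ℤ + + n * y + + (n choose 2) * (y * y) + y * y * y * s)
    ≡⟨ identity y (+ n) (+ (n choose 2)) s ⟩
  1ℤ + (1ℤ + + n) * y + (+ n + + (n choose 2)) * (y * y) + y * y * y * (s + + (n choose 2) + y * s)
    ≡⟨ cong₂ (λ a b → 1ℤ + a * y + b * (y * y) + y * y * y * (s + + (n choose 2) + y * s)) (sym (ℤ.pos-+ 1 n)) choose-2 ⟩
  1ℤ + + suc n * y + + (suc n choose 2) * (y * y) + y * y * y * (s + + (n choose 2) + y * s) ∎)
  where
  open ≡-Reasoning
  identity : ∀ y N T s → (1ℤ + y) * (1ℤ + N * y + T * (y * y) + y * y * y * s)
                       ≡ 1ℤ + (1ℤ + N) * y + (N + T) * (y * y) + y * y * y * (s + T + y * s)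
  identity = solve-∀
  choose-2 : + n + + (n choose 2) ≡ + (suc n choose 2)
  choose-2 = trans (sym (ℤ.pos-+ n (n choose 2)))
                   (cong +_ (trans (cong (ℕ._+ (n choose 2)) (sym (nC1≡n n))) (nCk+nC[k+1]≡[n+1]C[k+1] n 1)))

-- Euler quotients

module _ {p : ℕ} (p-prime : Prime p) (p≢2 : p ≢ 2) where

  private
    instance
      p≢0 : NonZero p
      p≢0 = prime⇒nonZero p-prime

    p^1+ : ∀ n → + (p ℕ.^ suc n) ≡ + p * + (p ℕ.^ n)
    p^1+ n = ℤ.pos-* p (p ℕ.^ n)

  EulerQuotient : ℕ → ℤ → ℤ → Set
  EulerQuotient m x A = x ^ ((p ∸ 1) ℕ.* p ℕ.^ m) ≈ 1ℤ + + (p ℕ.^ suc m) * A [mod p ℕ.^ suc (suc m) ]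

  EulerQuotient-zero : ∀ {x A} → x ^ (p ∸ 1) ≡ 1ℤ + + p * A → EulerQuotient 0 x A
  EulerQuotient-zero {x} {A} eq = ≈-reflexive (begin
    x ^ ((p ∸ 1) ℕ.* 1)      ≡⟨ cong (x ^_) (ℕ.*-identityʳ (p ∸ 1)) ⟩
    x ^ (p ∸ 1)              ≡⟨ eq ⟩
    1ℤ + + p * A             ≡⟨ cong (λ q → 1ℤ + + q * A) (ℕ.*-identityʳ p) ⟨
    1ℤ + + (p ℕ.* 1) * A     ∎)
    where open ≡-Reasoning

  private
    ^-φ-suc : ∀ x m → x ^ ((p ∸ 1) ℕ.* p ℕ.^ suc m) ≡ (x ^ ((p ∸ 1) ℕ.* p ℕ.^ m)) ^ p
    ^-φ-suc x m = begin
      x ^ ((p ∸ 1) ℕ.* (p ℕ.* p ℕ.^ m))   ≡⟨ cong (λ e → x ^ ((p ∸ 1) ℕ.* e)) (ℕ.*-comm p (p ℕ.^ m)) ⟩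
      x ^ ((p ∸ 1) ℕ.* (p ℕ.^ m ℕ.* p))   ≡⟨ cong (x ^_) (ℕ.*-assoc (p ∸ 1) (p ℕ.^ m) p) ⟨
      x ^ ((p ∸ 1) ℕ.* p ℕ.^ m ℕ.* p)     ≡⟨ ℤ.^-*-assoc x ((p ∸ 1) ℕ.* p ℕ.^ m) p ⟨
      (x ^ ((p ∸ 1) ℕ.* p ℕ.^ m)) ^ p     ∎
      where open ≡-Reasoning

  -- In (1 + p^(m+1) A) ^ p the quadratic term (p choose 2) p^(2m+2) A² vanishes modulo p^(m+3)
  -- only because p divides (p choose 2), which needs p odd.
  EulerQuotient-suc : ∀ {m x A} → EulerQuotient m x A → EulerQuotient (suc m) x A
  EulerQuotient-suc {m} {x} {A} (mod-intro (divides C eq)) with binomial-cubic p (+ p * + (p ℕ.^ m) * (A + + p * C))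
  ... | s , expansion = begin
    x ^ ((p ∸ 1) ℕ.* p ℕ.^ suc m)                         ≡⟨ ^-φ-suc x m ⟩
    (x ^ ((p ∸ 1) ℕ.* p ℕ.^ m)) ^ p                       ≡⟨ cong (_^ p) base ⟩
    (1ℤ + Y) ^ p                                          ≡⟨ expansion ⟩
    1ℤ + P * Y + + (p choose 2) * (Y * Y) + Y * Y * Y * s
      ≈⟨ +-cong-≈ (+-congˡ-≈ (1ℤ + P * Y) (∣⇒≈0 quadratic)) (∣⇒≈0 cubic) ⟩
    1ℤ + P * Y + 0ℤ + 0ℤ                                  ≡⟨ linear ⟩
    1ℤ + + (p ℕ.^ suc (suc m)) * A + C * M
      ≈⟨ +-congˡ-≈ (1ℤ + + (p ℕ.^ suc (suc m)) * A) (∣⇒≈0 (divides C refl)) ⟩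
    1ℤ + + (p ℕ.^ suc (suc m)) * A + 0ℤ                    ≡⟨ ℤ.+-identityʳ _ ⟩
    1ℤ + + (p ℕ.^ suc (suc m)) * A                         ∎
    where
    open ≈-Reasoning (p ℕ.^ suc (suc (suc m)))
    P = + p
    R = + (p ℕ.^ m)
    M = + (p ℕ.^ suc (suc (suc m)))
    Y = P * R * (A + P * C)
    M≡ : M ≡ P * (P * (P * R))
    M≡ = trans (p^1+ (suc (suc m))) (cong (P *_) (trans (p^1+ (suc m)) (cong (P *_) (p^1+ m))))
    base : x ^ ((p ∸ 1) ℕ.* p ℕ.^ m) ≡ 1ℤ + Y
    base = trans (x-y≡z⇒x≡y+z eq) (trans (cong₂ (λ q q′ → 1ℤ + q * A + C * q′) (p^1+ m) (trans (p^1+ (suc m)) (cong (P *_) (p^1+ m))))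
                                         (identity P R A C))
      where
      identity : ∀ P R A C → 1ℤ + P * R * A + C * (P * (P * R)) ≡ 1ℤ + P * R * (A + P * C)
      identity = solve-∀
    2<p : 2 < p
    2<p = ℕ.≤∧≢⇒< (prime>1 p-prime) (p≢2 ∘ sym)
    p∣[p-choose-2] : p ℕ.∣ p choose 2
    p∣[p-choose-2] = prime∣pCk p-prime (ℕ.s≤s ℕ.z≤n) 2<p
    τ = + ℕ.quotient p∣[p-choose-2]
    Q₂ = τ * R * (A + P * C) * (A + P * C)
    Q₃ = R * R * (A + P * C) * (A + P * C) * (A + P * C) * s
    quadratic : M ∣ + (p choose 2) * (Y * Y)
    quadratic = divides Q₂
      (trans (cong (λ c → + c * (Y * Y)) (trans (ℕ.m∣n⇒n≡quotient*m p∣[p-choose-2]) (ℕ.*-comm _ p)))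
      (trans (cong (_* (Y * Y)) (ℤ.pos-* p _))
      (trans (identity P τ R (A + P * C)) (cong (Q₂ *_) (sym M≡)))))
      where
      identity : ∀ P τ R Z → P * τ * (P * R * Z * (P * R * Z)) ≡ τ * R * Z * Z * (P * (P * (P * R)))
      identity = solve-∀
    cubic : M ∣ Y * Y * Y * s
    cubic = divides Q₃ (trans (identity P R (A + P * C) s) (cong (Q₃ *_) (sym M≡)))
      where
      identity : ∀ P R Z s → P * R * Z * (P * R * Z) * (P * R * Z) * s ≡ R * R * Z * Z * Z * s * (P * (P * (P * R)))
      identity = solve-∀
    linear : 1ℤ + P * Y + 0ℤ + 0ℤ ≡ 1ℤ + + (p ℕ.^ suc (suc m)) * A + C * M
    linear = trans (identity P R A C) (cong₂ (λ q q′ → 1ℤ + q * A + C * q′)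
               (sym (trans (p^1+ (suc m)) (cong (P *_) (p^1+ m)))) (sym M≡))
      where
      identity : ∀ P R A C → 1ℤ + P * (P * R * (A + P * C)) + 0ℤ + 0ℤ ≡ 1ℤ + P * (P * R) * A + C * (P * (P * (P * R)))
      identity = solve-∀

  private
    fermat-quotient : + p ∤ x → ∃ λ A → x ^ (p ∸ 1) ≡ 1ℤ + + p * A
    fermat-quotient p∤x with fermat-unit p-prime p∤x
    ... | mod-intro (divides A eq) = A , trans (x-y≡z⇒x≡y+z eq) (cong (_+_ 1ℤ) (ℤ.*-comm A (+ p)))

    EulerQuotient-all : ∀ {x A} → x ^ (p ∸ 1) ≡ 1ℤ + + p * A → ∀ m → EulerQuotient m x A
    EulerQuotient-all eq zero    = EulerQuotient-zero eq
    EulerQuotient-all eq (suc m) = EulerQuotient-suc {m = m} (EulerQuotient-all eq m)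

    -- The linear term of the binomial expansion of (x + p) ^ (p - 1) makes the quotients of x and
    -- x + p differ by (p - 1) x ^ (p - 2) modulo p.
    quotient-shift : ∀ {x A A′} → + p ∤ x → x ^ (p ∸ 1) ≡ 1ℤ + + p * A → (x + + p) ^ (p ∸ 1) ≡ 1ℤ + + p * A′ →
                     + p ∤ A′ - A
    quotient-shift {x} {A} {A′} p∤x eqA eqA′ = p∤K ∘ ∣-resp-≈ A′-A≈K
      where
      P = + p
      r = ℕ.pred (p ∸ 1)
      1+r≡p∸1 : suc r ≡ p ∸ 1
      1+r≡p∸1 = ℕ.suc-pred (p ∸ 1) {{p∸1≢0 p-prime}}
      K = + (p ∸ 1) * x ^ r
      p∤K : P ∤ K
      p∤K = ∤-* p-prime (∤-small p-prime (ℕ.m<n⇒0<n∸m (prime>1 p-prime)) (p∸1<p p-prime)) (∤-^ p-prime p∤x r)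
      p²∣P² : + (p ℕ.* p) ∣ P * P
      p²∣P² = divides 1ℤ (trans (sym (ℤ.pos-* p p)) (sym (ℤ.*-identityˡ (+ (p ℕ.* p)))))
      pA′≈p[A+K] : P * A′ ≈ P * (A + K) [mod p ℕ.* p ]
      pA′≈p[A+K] = begin
        P * A′                                         ≡⟨ identity₁ P A′ ⟩
        1ℤ + P * A′ - 1ℤ                               ≡⟨ cong (_- 1ℤ) eqA′ ⟨
        (x + P) ^ (p ∸ 1) - 1ℤ                         ≡⟨ cong (λ k → (x + P) ^ k - 1ℤ) 1+r≡p∸1 ⟨
        (x + P) ^ suc r - 1ℤ                           ≈⟨ +-congʳ-≈ (- 1ℤ) (binomial-linear-≈ x P p²∣P² r) ⟩
        x ^ suc r + + suc r * (x ^ r * P) - 1ℤ         ≡⟨ cong (λ k → x ^ k + + k * (x ^ r * P) - 1ℤ) 1+r≡p∸1 ⟩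
        x ^ (p ∸ 1) + + (p ∸ 1) * (x ^ r * P) - 1ℤ     ≡⟨ cong (λ z → z + + (p ∸ 1) * (x ^ r * P) - 1ℤ) eqA ⟩
        1ℤ + P * A + + (p ∸ 1) * (x ^ r * P) - 1ℤ      ≡⟨ identity₂ P A (+ (p ∸ 1)) (x ^ r) ⟩
        P * (A + K)                                    ∎
        where
        open ≈-Reasoning (p ℕ.* p)
        identity₁ : ∀ P A → P * A ≡ 1ℤ + P * A - 1ℤ
        identity₁ = solve-∀
        identity₂ : ∀ P A c X → 1ℤ + P * A + c * (X * P) - 1ℤ ≡ P * (A + c * X)
        identity₂ = solve-∀
      A′-A≈K : A′ - A ≈ K [mod p ]
      A′-A≈K = begin
        A′ - A              ≈⟨ +-congʳ-≈ (- A) (≈-cancel-factor p pA′≈p[A+K]) ⟩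
        A + K - A           ≡⟨ identity A K ⟩
        K                   ∎
        where
        open ≈-Reasoning p
        identity : ∀ A K → A + K - A ≡ K
        identity = solve-∀

  EulerQuotient-shift : + p ∤ x → ∃₂ λ A A′ →
    (∀ m → EulerQuotient m x A) × (∀ m → EulerQuotient m (x + + p) A′) × + p ∤ A′ - A
  EulerQuotient-shift {x} p∤x =
    A , A′ , EulerQuotient-all eqA , EulerQuotient-all eqA′ , quotient-shift p∤x eqA eqA′
    where
    A = proj₁ (fermat-quotient p∤x)
    eqA = proj₂ (fermat-quotient p∤x)
    A′ = proj₁ (fermat-quotient (p∤x ∘ ∣-resp-≈ (x+m≈x x)))
    eqA′ = proj₂ (fermat-quotient (p∤x ∘ ∣-resp-≈ (x+m≈x x)))

  euler : + p ∤ x → ∀ m → x ^ ((p ∸ 1) ℕ.* p ℕ.^ m) ≈ 1ℤ [mod p ℕ.^ suc m ]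
  euler {x} p∤x m = begin
    x ^ ((p ∸ 1) ℕ.* p ℕ.^ m)     ≈⟨ ≈-weaken (ℕ.n∣m*n p) (EulerQuotient-all (proj₂ (fermat-quotient p∤x)) m) ⟩
    1ℤ + + (p ℕ.^ suc m) * A      ≈⟨ +-congˡ-≈ 1ℤ (∣⇒≈0 (∣m⇒∣m*n A ∣-refl)) ⟩
    1ℤ + 0ℤ                       ≡⟨ ℤ.+-identityʳ 1ℤ ⟩
    1ℤ                            ∎
    where
    open ≈-Reasoning (p ℕ.^ suc m)
    A = proj₁ (fermat-quotient p∤x)

-- Euler's totient of a prime power

count : ∀ {P : Pred ℕ 0ℓ} → Decidable P → ℕ → ℕ
count P? n = length (filter P? (map suc (upTo n)))

module _ {P : Pred ℕ 0ℓ} (P? : Decidable P) where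

  private
    count-∷ʳ : ∀ n → count P? (suc n) ≡ count P? n ℕ.+ length (filter P? [ suc n ])
    count-∷ʳ n = begin
      length (filter P? (map suc (upTo (suc n))))
        ≡⟨ cong (length ∘ filter P? ∘ map suc) (List.upTo-∷ʳ n) ⟨
      length (filter P? (map suc (upTo n ++ [ n ])))
        ≡⟨ cong (length ∘ filter P?) (List.map-++ suc (upTo n) [ n ]) ⟩
      length (filter P? (map suc (upTo n) ++ [ suc n ]))
        ≡⟨ cong length (List.filter-++ P? (map suc (upTo n)) [ suc n ]) ⟩
      length (filter P? (map suc (upTo n)) ++ filter P? [ suc n ])
        ≡⟨ List.length-++ (filter P? (map suc (upTo n))) ⟩
      count P? n ℕ.+ length (filter P? [ suc n ])                      ∎
      where open ≡-Reasoning

  count-accept : ∀ n → P (suc n) → count P? (suc n) ≡ suc (count P? n)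
  count-accept n P[1+n] = trans (count-∷ʳ n)
    (trans (cong (λ xs → count P? n ℕ.+ length xs) (List.filter-accept P? P[1+n])) (ℕ.+-comm (count P? n) 1))

  count-reject : ∀ n → ¬ P (suc n) → count P? (suc n) ≡ count P? n
  count-reject n ¬P[1+n] = trans (count-∷ʳ n)
    (trans (cong (λ xs → count P? n ℕ.+ length xs) (List.filter-reject P? ¬P[1+n])) (ℕ.+-identityʳ (count P? n)))

count-cong : ∀ {P Q : Pred ℕ 0ℓ} (P? : Decidable P) (Q? : Decidable Q) → (∀ {i} → P i → Q i) → (∀ {i} → Q i → P i) →
             ∀ n → count P? n ≡ count Q? n
count-cong P? Q? P⇒Q Q⇒P n = cong length (List.filter-≐ P? Q? (P⇒Q , Q⇒P) (map suc (upTo n)))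

module _ {p : ℕ} (p-prime : Prime p) where

  private
    instance
      p≢0 : NonZero p
      p≢0 = prime⇒nonZero p-prime

    indivisible? : Decidable (λ i → ¬ p ℕ.∣ i)
    indivisible? i = ¬? (p ℕ.∣? i)

    count-block : ∀ N j → j < p → count indivisible? (N ℕ.* p ℕ.+ j) ≡ count indivisible? (N ℕ.* p) ℕ.+ j
    count-block N zero    _   = trans (cong (count indivisible?) (ℕ.+-identityʳ (N ℕ.* p))) (sym (ℕ.+-identityʳ _))
    count-block N (suc j) j<p = begin
      count indivisible? (N ℕ.* p ℕ.+ suc j)           ≡⟨ cong (count indivisible?) (ℕ.+-suc (N ℕ.* p) j) ⟩
      count indivisible? (suc (N ℕ.* p ℕ.+ j))         ≡⟨ count-accept indivisible? (N ℕ.* p ℕ.+ j) p∤ ⟩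
      suc (count indivisible? (N ℕ.* p ℕ.+ j))         ≡⟨ cong suc (count-block N j (ℕ.<-trans (ℕ.n<1+n j) j<p)) ⟩
      suc (count indivisible? (N ℕ.* p) ℕ.+ j)         ≡⟨ ℕ.+-suc _ j ⟨
      count indivisible? (N ℕ.* p) ℕ.+ suc j           ∎
      where
      open ≡-Reasoning
      p∤ : ¬ p ℕ.∣ suc (N ℕ.* p ℕ.+ j)
      p∤ p∣ = ℕ.>⇒∤ j<p (ℕ.∣m+n∣m⇒∣n (subst (p ℕ.∣_) (sym (ℕ.+-suc (N ℕ.* p) j)) p∣) (ℕ.n∣m*n N))

    count-multiple : ∀ N → count indivisible? (N ℕ.* p) ≡ N ℕ.* (p ∸ 1)
    count-multiple zero    = refl
    count-multiple (suc N) = begin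
      count indivisible? (suc N ℕ.* p)                      ≡⟨ cong (count indivisible?) [1+N]p≡ ⟩
      count indivisible? (suc (N ℕ.* p ℕ.+ (p ∸ 1)))        ≡⟨ count-reject indivisible? _ (λ p∤ → p∤ p∣) ⟩
      count indivisible? (N ℕ.* p ℕ.+ (p ∸ 1))              ≡⟨ count-block N (p ∸ 1) (p∸1<p p-prime) ⟩
      count indivisible? (N ℕ.* p) ℕ.+ (p ∸ 1)              ≡⟨ cong (ℕ._+ (p ∸ 1)) (count-multiple N) ⟩
      N ℕ.* (p ∸ 1) ℕ.+ (p ∸ 1)                             ≡⟨ ℕ.+-comm (N ℕ.* (p ∸ 1)) (p ∸ 1) ⟩
      suc N ℕ.* (p ∸ 1)                                     ∎
      where
      open ≡-Reasoning
      [1+N]p≡ : suc N ℕ.* p ≡ suc (N ℕ.* p ℕ.+ (p ∸ 1))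
      [1+N]p≡ = begin
        p ℕ.+ N ℕ.* p              ≡⟨ ℕ.+-comm p (N ℕ.* p) ⟩
        N ℕ.* p ℕ.+ p              ≡⟨ cong (N ℕ.* p ℕ.+_) (p≡1+[p∸1] p-prime) ⟩
        N ℕ.* p ℕ.+ suc (p ∸ 1)    ≡⟨ ℕ.+-suc (N ℕ.* p) (p ∸ 1) ⟩
        suc (N ℕ.* p ℕ.+ (p ∸ 1))  ∎
      p∣ : p ℕ.∣ suc (N ℕ.* p ℕ.+ (p ∸ 1))
      p∣ = subst (p ℕ.∣_) [1+N]p≡ (ℕ.n∣m*n (suc N))

    ∤⇒coprime-^ : ∀ {i} → ¬ p ℕ.∣ i → ∀ k → Coprime i (p ℕ.^ k)
    ∤⇒coprime-^ p∤i zero    (_ , d∣1)       = ℕ.∣1⇒≡1 d∣1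
    ∤⇒coprime-^ p∤i (suc k) (d∣i , d∣p^1+k) =
      ∤⇒coprime-^ p∤i k (d∣i , coprime-divisor (λ (e∣d , e∣p) → ∤⇒coprime p-prime p∤i (ℕ.∣-trans e∣d d∣i , e∣p)) d∣p^1+k)

    coprime⇒∤ : ∀ {i k} → Coprime i (p ℕ.^ suc k) → ¬ p ℕ.∣ i
    coprime⇒∤ {k = k} coprime p∣i = ℕ.<⇒≢ (prime>1 p-prime) (sym (coprime (p∣i , ℕ.m∣m*n (p ℕ.^ k))))

  φ-prime-power : ∀ m → φ (p ℕ.^ suc m) ≡ (p ∸ 1) ℕ.* p ℕ.^ m
  φ-prime-power m = begin
    count (λ i → coprime? i (p ℕ.^ suc m)) (p ℕ.^ suc m)
      ≡⟨ count-cong (λ i → coprime? i (p ℕ.^ suc m)) indivisible?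
           (coprime⇒∤ {k = m}) (λ p∤i → ∤⇒coprime-^ p∤i (suc m)) (p ℕ.^ suc m) ⟩
    count indivisible? (p ℕ.* p ℕ.^ m)                     ≡⟨ cong (count indivisible?) (ℕ.*-comm p (p ℕ.^ m)) ⟩
    count indivisible? (p ℕ.^ m ℕ.* p)                     ≡⟨ count-multiple (p ℕ.^ m) ⟩
    p ℕ.^ m ℕ.* (p ∸ 1)                                    ≡⟨ ℕ.*-comm (p ℕ.^ m) (p ∸ 1) ⟩
    (p ∸ 1) ℕ.* p ℕ.^ m                                    ∎
    where open ≡-Reasoning

-- Comparing two polynomials that reduce well

module _ {p : ℕ} (h : Poly) (reduces-well : ReducesWell p h) where

  ReducesWell⇒coeff-∤ : ∀ j → + p ∤ coeff h j
  ReducesWell⇒coeff-∤ j = proj₁ reduces-well j ∘ ∣⇒∣ᵤ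

  ReducesWell⇒expo-injective : ∀ j l → + expo h j ≈ + expo h l [mod p ∸ 1 ] → j ≡ l
  ReducesWell⇒expo-injective j l αj≈αl with j Fin.≟ l
  ... | yes j≡l = j≡l
  ... | no j≢l  = contradiction (≈⇒≋ αj≈αl) (proj₂ reduces-well j l j≢l)

module Comparison {p : ℕ} (p-prime : Prime p) (p≢2 : p ≢ 2) (f g : Poly)
         (f-reduces-well : ReducesWell p f) (g-reduces-well : ReducesWell p g) where

  private
    instance
      p∸1-nonZero : NonZero (p ∸ 1)
      p∸1-nonZero = p∸1≢0 p-prime
      p≢0 : NonZero p
      p≢0 = prime⇒nonZero p-prime

  Matched : Fin (t f) ⤖ Fin (t g) → ℕ → Set
  Matched σ m = ∀ j → coeff f j ≈ coeff g (Bijection.to σ j) [mod p ℕ.^ suc m ] ×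
                      + expo f j ≈ + expo g (Bijection.to σ j) [mod (p ∸ 1) ℕ.* p ℕ.^ m ]

  AgreeAtPairs : ℕ → Set
  AgreeAtPairs m = ∀ i → 1 ≤ i → i ≤ p ∸ 1 →
    eval f (+ i) ≈ eval g (+ i) [mod p ℕ.^ suc m ] × eval f (+ i + + p) ≈ eval g (+ i + + p) [mod p ℕ.^ suc m ]

  AgreeAtPairs-weaken : ∀ {m} → AgreeAtPairs (suc m) → AgreeAtPairs m
  AgreeAtPairs-weaken agree i 1≤i i≤p∸1 with agree i 1≤i i≤p∸1
  ... | at-i , at-i+p = ≈-weaken (ℕ.n∣m*n p) at-i , ≈-weaken (ℕ.n∣m*n p) at-i+p

  termwise-difference : Fin (t f) ⤖ Fin (t g) → ℤ → Fin (t f) → ℤ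
  termwise-difference σ x j = coeff f j * x ^ expo f j - coeff g (Bijection.to σ j) * x ^ expo g (Bijection.to σ j)

  eval-difference : ∀ σ x → eval f x - eval g x ≡ sum (termwise-difference σ x)
  eval-difference σ x = begin
    eval f x - eval g x
      ≡⟨ cong₂ _-_ (eval≡sparse f x) (trans (eval≡sparse g x) (sum-reindex σ (λ l → coeff g l * x ^ expo g l))) ⟩
    sum (λ j → coeff f j * x ^ expo f j) - sum (λ j → coeff g (Bijection.to σ j) * x ^ expo g (Bijection.to σ j))
      ≡⟨ ∑-distrib-- (λ j → coeff f j * x ^ expo f j) (λ j → coeff g (Bijection.to σ j) * x ^ expo g (Bijection.to σ j)) ⟨
    sum (termwise-difference σ x)
      ∎
    where open ≡-Reasoning

  Matched⇒agree : ∀ σ {m} → Matched σ m → ∀ x → + p ∤ x → eval f x ≈ eval g x [mod p ℕ.^ suc m ]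
  Matched⇒agree σ {m} matched x p∤x =
    mod-intro (∣-≡ (sym (eval-difference σ x)) (∣-sum (termwise-difference σ x) term))
    where
    term : ∀ j → + (p ℕ.^ suc m) ∣ termwise-difference σ x j
    term j = ∣-difference (*-cong-≈ (proj₁ (matched j)) (^-cong-exponent (euler p-prime p≢2 p∤x m) (proj₂ (matched j))))

  Matched-zero : (∀ i → 1 ≤ i → i ≤ p ∸ 1 → eval f (+ i) ≈ eval g (+ i) [mod p ]) → Σ[ σ ∈ Fin (t f) ⤖ Fin (t g) ] Matched σ 0
  Matched-zero agree = σ , matched
    where
    α-injective : ∀ j l → expo f j mod (p ∸ 1) ≡ expo f l mod (p ∸ 1) → j ≡ l
    α-injective j l = ReducesWell⇒expo-injective f f-reduces-well j l ∘ mod⇒≈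
    β-injective : ∀ j l → expo g j mod (p ∸ 1) ≡ expo g l mod (p ∸ 1) → j ≡ l
    β-injective j l = ReducesWell⇒expo-injective g g-reduces-well j l ∘ mod⇒≈
    same-residues : ∀ r → residue-coeff (p ∸ 1) (coeff f) (expo f) r ≈ residue-coeff (p ∸ 1) (coeff g) (expo g) r [mod p ]
    same-residues = agree⇒residue-coeff≈ p-prime (coeff f) (expo f) (coeff g) (expo g)
      (λ i 1≤i i≤p∸1 → subst₂ (λ y z → y ≈ z [mod p ]) (eval≡sparse f (+ i)) (eval≡sparse g (+ i)) (agree i 1≤i i≤p∸1))
    forward : ∀ j → Σ[ l ∈ Fin (t g) ] expo g l mod (p ∸ 1) ≡ expo f j mod (p ∸ 1)
    forward j = residue-partner p-prime (coeff f) (expo f) (coeff g) (expo g) same-residues α-injective j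
                  (ReducesWell⇒coeff-∤ f f-reduces-well j)
    backward : ∀ l → Σ[ j ∈ Fin (t f) ] expo f j mod (p ∸ 1) ≡ expo g l mod (p ∸ 1)
    backward l = residue-partner p-prime (coeff g) (expo g) (coeff f) (expo f) (≈-sym ∘ same-residues) β-injective l
                   (ReducesWell⇒coeff-∤ g g-reduces-well l)
    to : Fin (t f) → Fin (t g)
    to = proj₁ ∘ forward
    σ : Fin (t f) ⤖ Fin (t g)
    σ = mk⤖ {to = to} (injective , surjective)
      where
      injective : ∀ {j j′} → to j ≡ to j′ → j ≡ j′
      injective {j} {j′} to-j≡to-j′ = α-injective j j′
        (trans (sym (proj₂ (forward j))) (trans (cong (λ l → expo g l mod (p ∸ 1)) to-j≡to-j′) (proj₂ (forward j′))))
      surjective : ∀ l → ∃ λ j → ∀ {j′} → j′ ≡ j → to j′ ≡ l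
      surjective l = j , λ { refl → β-injective (to j) l (trans (proj₂ (forward j)) (proj₂ (backward l))) }
        where j = proj₁ (backward l)
    matched : Matched σ 0
    matched j = ≈-weaken (ℕ.∣-reflexive (ℕ.*-identityʳ p)) (begin
      coeff f j
        ≡⟨ residue-coeff-at (p ∸ 1) (coeff f) (expo f) α-injective j ⟨
      residue-coeff (p ∸ 1) (coeff f) (expo f) (expo f j mod (p ∸ 1))  ≈⟨ same-residues (expo f j mod (p ∸ 1)) ⟩
      residue-coeff (p ∸ 1) (coeff g) (expo g) (expo f j mod (p ∸ 1))
        ≡⟨ cong (residue-coeff (p ∸ 1) (coeff g) (expo g)) (proj₂ (forward j)) ⟨
      residue-coeff (p ∸ 1) (coeff g) (expo g) (expo g (to j) mod (p ∸ 1))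
        ≡⟨ residue-coeff-at (p ∸ 1) (coeff g) (expo g) β-injective (to j) ⟩
      coeff g (to j)                                               ∎)
      , ≈-weaken (ℕ.∣-reflexive (ℕ.*-identityʳ (p ∸ 1))) (mod⇒≈ (sym (proj₂ (forward j))))
      where open ≈-Reasoning p

  module _ (σ : Fin (t f) ⤖ Fin (t g)) {m : ℕ} (matched : Matched σ m) where

    private
      cf cg : Fin (t f) → ℤ
      cf = coeff f
      cg = coeff g ∘ Bijection.to σ
      ef eg : Fin (t f) → ℕ
      ef = expo f
      eg = expo g ∘ Bijection.to σ
      D = (p ∸ 1) ℕ.* p ℕ.^ m
      q = p ℕ.^ suc m

      instance
        q≢0 : NonZero q
        q≢0 = ℕ.m^n≢0 p (suc m)

      split : ∀ j → CommonBase D (ef j) (eg j)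
      split j = ≈⇒CommonBase (proj₂ (matched j))
      r u v : Fin (t f) → ℕ
      r = CommonBase.base ∘ split
      u = CommonBase.u ∘ split
      v = CommonBase.v ∘ split

      e : Fin (t f) → ℤ
      e j = proj₁ (∣⇒≡multiple (∣-difference (proj₁ (matched j))))
      e-eq : ∀ j → cf j - cg j ≡ e j * + q
      e-eq j = proj₂ (∣⇒≡multiple (∣-difference (proj₁ (matched j))))

      δ : Fin (t f) → ℤ
      δ j = cf j * (+ u j - + v j)

      p^[2+m]∣q² : + (p ℕ.^ suc (suc m)) ∣ + q * + q
      p^[2+m]∣q² = ∣ᵤ⇒∣ (subst (p ℕ.* q ℕ.∣_) (sym (ℤ.abs-* (+ q) (+ q)))
                                (ℕ.*-monoˡ-∣ {m = p} q (ℕ.m∣m*n (p ℕ.^ m))))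

    difference-expansion : ∀ {x A} → EulerQuotient p-prime p≢2 m x A →
      eval f x - eval g x ≈ + q * (sparse e r x + A * sparse δ r x) [mod p ℕ.^ suc (suc m) ]
    difference-expansion {x} {A} quotient = begin
      eval f x - eval g x
        ≡⟨ eval-difference σ x ⟩
      sum (termwise-difference σ x)
        ≡⟨ sum-cong-≗ (λ j → cong₂ (λ α β → cf j * x ^ α - cg j * x ^ β)
                                    (CommonBase.α≡ (split j)) (CommonBase.β≡ (split j))) ⟩
      sum (λ j → cf j * x ^ (r j ℕ.+ u j ℕ.* D) - cg j * x ^ (r j ℕ.+ v j ℕ.* D))
        ≈⟨ sum-cong-≈ (λ j → term-expansion (cf j) (cg j) (e j) x A (r j) (u j) (v j) p^[2+m]∣q² (e-eq j) quotient) ⟩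
      sum (λ j → + q * (e j * x ^ r j + A * (δ j * x ^ r j)))
        ≡⟨ *-distribˡ-sum (+ q) (λ j → e j * x ^ r j + A * (δ j * x ^ r j)) ⟨
      + q * sum (λ j → e j * x ^ r j + A * (δ j * x ^ r j))
        ≡⟨ cong (+ q *_) (∑-distrib-+ (λ j → e j * x ^ r j) (λ j → A * (δ j * x ^ r j))) ⟩
      + q * (sparse e r x + sum (λ j → A * (δ j * x ^ r j)))
        ≡⟨ cong (λ z → + q * (sparse e r x + z)) (*-distribˡ-sum A (λ j → δ j * x ^ r j)) ⟨
      + q * (sparse e r x + A * sparse δ r x)
        ∎
      where open ≈-Reasoning (p ℕ.^ suc (suc m))

    agreement⇒p∣combination : ∀ {x A} → EulerQuotient p-prime p≢2 m x A →
      eval f x ≈ eval g x [mod p ℕ.^ suc (suc m) ] → + p ∣ sparse e r x + A * sparse δ r x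
    agreement⇒p∣combination {x} {A} quotient f≈g =
      ≈0⇒∣ (≈-cancel-factor q (≈-weaken (ℕ.∣-reflexive (ℕ.*-comm q p)) (begin
      + q * (sparse e r x + A * sparse δ r x)  ≈⟨ difference-expansion quotient ⟨
      eval f x - eval g x                     ≈⟨ ∣⇒≈0 (∣-difference f≈g) ⟩
      0ℤ                                      ≡⟨ ℤ.*-zeroʳ (+ q) ⟨
      + q * 0ℤ                                ∎)))
      where open ≈-Reasoning (p ℕ.^ suc (suc m))

    -- Comparing the test points i and i + p, which have Euler quotients differing by a unit,
    -- separates the two parts of the combination.
    test-point-vanishing : AgreeAtPairs (suc m) → ∀ i → 1 ≤ i → i ≤ p ∸ 1 → + p ∣ sparse δ r (+ i) × + p ∣ sparse e r (+ i)
    test-point-vanishing agree i 1≤i i≤p∸1 = p∣W , p∣E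
      where
      p∤i : + p ∤ + i
      p∤i = ∤-small p-prime 1≤i (ℕ.≤-<-trans i≤p∸1 (p∸1<p p-prime))
      shift = EulerQuotient-shift p-prime p≢2 {x = + i} p∤i
      A = proj₁ shift
      A′ = proj₁ (proj₂ shift)
      E W : ℤ → ℤ
      E = sparse e r
      W = sparse δ r
      at-i : + p ∣ E (+ i) + A * W (+ i)
      at-i = agreement⇒p∣combination (proj₁ (proj₂ (proj₂ shift)) m) (proj₁ (agree i 1≤i i≤p∸1))
      at-i+p : + p ∣ E (+ i + + p) + A′ * W (+ i + + p)
      at-i+p = agreement⇒p∣combination (proj₁ (proj₂ (proj₂ (proj₂ shift))) m) (proj₂ (agree i 1≤i i≤p∸1))
      shifted : + p ∣ E (+ i) + A′ * W (+ i)
      shifted = ∣-resp-≈ (+-cong-≈ (sparse-cong-≈ e r i+p≈i) (*-congˡ-≈ A′ (sparse-cong-≈ δ r i+p≈i))) at-i+p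
        where i+p≈i = x+m≈x (+ i)
      p∣W : + p ∣ W (+ i)
      p∣W = ∤-cancelˡ p-prime (proj₂ (proj₂ (proj₂ (proj₂ shift))))
              (∣-≡ (identity (E (+ i)) (W (+ i)) A A′) (∣m∣n⇒∣m+n shifted (∣m⇒∣-m at-i)))
        where
        identity : ∀ E W A A′ → E + A′ * W + - (E + A * W) ≡ (A′ - A) * W
        identity = solve-∀
      p∣E : + p ∣ E (+ i)
      p∣E = ∣-≡ (identity (E (+ i)) (W (+ i)) A) (∣m∣n⇒∣m+n at-i (∣m⇒∣-m (∣n⇒∣m*n A p∣W)))
        where
        identity : ∀ E W A → E + A * W + - (A * W) ≡ E
        identity = solve-∀

    private
      r-injective : ∀ j l → + r j ≈ + r l [mod p ∸ 1 ] → j ≡ l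
      r-injective j l rj≈rl = ReducesWell⇒expo-injective f f-reduces-well j l
        (≈-trans (≈-sym (r≈ef j)) (≈-trans rj≈rl (r≈ef l)))
        where
        r≈ef : ∀ j → + r j ≈ + ef j [mod p ∸ 1 ]
        r≈ef j = ≈-weaken (ℕ.m∣m*n (p ℕ.^ m))
          (CommonBase⇒≈ (common-base (r j) 0 (u j) (sym (ℕ.+-identityʳ (r j))) (CommonBase.α≡ (split j))))

      D-suc : p ℕ.* D ≡ (p ∸ 1) ℕ.* p ℕ.^ suc m
      D-suc = begin
        p ℕ.* ((p ∸ 1) ℕ.* p ℕ.^ m)    ≡⟨ ℕ.*-assoc p (p ∸ 1) (p ℕ.^ m) ⟨
        p ℕ.* (p ∸ 1) ℕ.* p ℕ.^ m      ≡⟨ cong (ℕ._* p ℕ.^ m) (ℕ.*-comm p (p ∸ 1)) ⟩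
        (p ∸ 1) ℕ.* p ℕ.* p ℕ.^ m      ≡⟨ ℕ.*-assoc (p ∸ 1) p (p ℕ.^ m) ⟩
        (p ∸ 1) ℕ.* (p ℕ.* p ℕ.^ m)    ∎
        where open ≡-Reasoning

    Matched-suc : AgreeAtPairs (suc m) → Matched σ (suc m)
    Matched-suc agree j =
      mod-intro (scale-∣ (p∣e j) (e-eq j)) ,
      mod-intro (subst (λ n → + n ∣ + ef j - + eg j) D-suc
                       (scale-∣ (p∣u-v j) (CommonBase-difference (split j))))
      where
      p∣e : ∀ j → + p ∣ e j
      p∣e = vanish⇒∣-coefficients p-prime e r r-injective (λ i 1≤i i≤p∸1 → proj₂ (test-point-vanishing agree i 1≤i i≤p∸1))
      p∣δ : ∀ j → + p ∣ δ j
      p∣δ = vanish⇒∣-coefficients p-prime δ r r-injective (λ i 1≤i i≤p∸1 → proj₁ (test-point-vanishing agree i 1≤i i≤p∸1))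
      p∣u-v : ∀ j → + p ∣ + u j - + v j
      p∣u-v j = ∤-cancelˡ p-prime (ReducesWell⇒coeff-∤ f f-reduces-well j) (p∣δ j)

  AgreeAtPairs⇒Matched : ∀ m → AgreeAtPairs m → Σ[ σ ∈ Fin (t f) ⤖ Fin (t g) ] Matched σ m
  AgreeAtPairs⇒Matched zero agree =
    Matched-zero (λ i 1≤i i≤p∸1 → ≈-weaken (ℕ.∣-reflexive (sym (ℕ.*-identityʳ p))) (proj₁ (agree i 1≤i i≤p∸1)))
  AgreeAtPairs⇒Matched (suc m) agree = σ , Matched-suc σ {m} matched agree
    where
    previous = AgreeAtPairs⇒Matched m (AgreeAtPairs-weaken {m} agree)
    σ = proj₁ previous
    matched = proj₂ previous

  TermsMatch AgreeOnUnits AgreeAtTestPoints : ℕ → Set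
  TermsMatch k = t f ≡ t g × Σ[ σ ∈ Fin (t f) ⤖ Fin (t g) ]
    (∀ j → (coeff f j ≋ coeff g (Bijection.to σ j) [mod p ℕ.^ k ])
         × ((+ expo f j) ≋ (+ expo g (Bijection.to σ j)) [mod φ (p ℕ.^ k) ]))
  AgreeOnUnits k = ∀ (x : ℤ) → ℤ.Coprime x (+ p) → eval f x ≋ eval g x [mod p ℕ.^ k ]
  AgreeAtTestPoints k = ∀ (i : ℕ) → ((1 ≤ i × i ≤ p ∸ 1) ⊎ (p ℕ.+ 1 ≤ i × i ≤ 2 ℕ.* p ∸ 1)) →
    eval f (+ i) ≋ eval g (+ i) [mod p ℕ.^ k ]

  private
    2p∸1≡p∸1+p : 2 ℕ.* p ∸ 1 ≡ (p ∸ 1) ℕ.+ p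
    2p∸1≡p∸1+p = trans (cong (λ z → (p ℕ.+ z) ∸ 1) (ℕ.+-identityʳ p)) (ℕ.+-∸-comm p (ℕ.<⇒≤ (prime>1 p-prime)))

    test-point-∤ : ∀ {i} → (1 ≤ i × i ≤ p ∸ 1) ⊎ (p ℕ.+ 1 ≤ i × i ≤ 2 ℕ.* p ∸ 1) → ¬ p ℕ.∣ i
    test-point-∤ (inj₁ (1≤i , i≤p∸1)) = ℕ.>⇒∤ {{ℕ.>-nonZero 1≤i}} (ℕ.≤-<-trans i≤p∸1 (p∸1<p p-prime))
    test-point-∤ {i} (inj₂ (p+1≤i , i≤2p∸1)) p∣i = test-point-∤ (inj₁ (1≤i∸p , i∸p≤p∸1))
        (ℕ.∣m+n∣m⇒∣n (subst (p ℕ.∣_) (sym (ℕ.m+[n∸m]≡n p≤i)) p∣i) ℕ.∣-refl)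
      where
      p≤i : p ≤ i
      p≤i = ℕ.≤-trans (ℕ.m≤m+n p 1) p+1≤i
      1≤i∸p : 1 ≤ i ∸ p
      1≤i∸p = subst (_≤ i ∸ p) (ℕ.m+n∸m≡n p 1) (ℕ.∸-monoˡ-≤ p p+1≤i)
      i∸p≤p∸1 : i ∸ p ≤ p ∸ 1
      i∸p≤p∸1 = subst (i ∸ p ≤_) (ℕ.m+n∸n≡m (p ∸ 1) p) (ℕ.∸-monoˡ-≤ p (subst (i ≤_) 2p∸1≡p∸1+p i≤2p∸1))

  TermsMatch⇒AgreeOnUnits : ∀ m → TermsMatch (suc m) → AgreeOnUnits (suc m)
  TermsMatch⇒AgreeOnUnits m (_ , σ , match) x coprime = ≈⇒≋ (Matched⇒agree σ {m} matched x p∤x)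
    where
    matched : Matched σ m
    matched j = ≋⇒≈ (proj₁ (match j)) ,
      ≋⇒≈ (subst (λ n → (+ expo f j) ≋ (+ expo g (Bijection.to σ j)) [mod n ]) (φ-prime-power p-prime m) (proj₂ (match j)))
    p∤x : + p ∤ x
    p∤x p∣x = ℕ.<⇒≢ (prime>1 p-prime) (sym (coprime (∣⇒∣ᵤ p∣x , ℕ.∣-refl)))

  AgreeOnUnits⇒AgreeAtTestPoints : ∀ k → AgreeOnUnits k → AgreeAtTestPoints k
  AgreeOnUnits⇒AgreeAtTestPoints k agree i test-point = agree (+ i) (∤⇒coprime p-prime (test-point-∤ test-point))

  AgreeAtTestPoints⇒TermsMatch : ∀ m → AgreeAtTestPoints (suc m) → TermsMatch (suc m)
  AgreeAtTestPoints⇒TermsMatch m tests = Permutation.↔⇒≡ (⤖⇒↔ σ) , σ , λ j →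
    ≈⇒≋ (proj₁ (matched j)) ,
    subst (λ n → (+ expo f j) ≋ (+ expo g (Bijection.to σ j)) [mod n ]) (sym (φ-prime-power p-prime m)) (≈⇒≋ (proj₂ (matched j)))
    where
    agree : AgreeAtPairs m
    agree i 1≤i i≤p∸1 =
      ≋⇒≈ (tests i (inj₁ (1≤i , i≤p∸1))) ,
      subst (λ z → eval f z ≈ eval g z [mod p ℕ.^ suc m ]) (ℤ.pos-+ i p)
        (≋⇒≈ (tests (i ℕ.+ p) (inj₂ (subst (_≤ i ℕ.+ p) (ℕ.+-comm 1 p) (ℕ.+-monoˡ-≤ p 1≤i) ,
                                      subst (i ℕ.+ p ≤_) (sym 2p∸1≡p∸1+p) (ℕ.+-monoˡ-≤ p i≤p∸1)))))
    σ = proj₁ (AgreeAtPairs⇒Matched m agree)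
    matched = proj₂ (AgreeAtPairs⇒Matched m agree)

corollary3p12 : (p : ℕ) → Prime p → p ≢ 2 → (f g : Poly) →
    ReducesWell p f → ReducesWell p g → (k : ℕ) → 1 ≤ k →
    ((t f ≡ t g × Σ[ σ ∈ Fin (t f) ⤖ Fin (t g) ]
        (∀ j → (coeff f j ≋ coeff g (Bijection.to σ j) [mod p ℕ.^ k ])
             × ((+ expo f j) ≋ (+ expo g (Bijection.to σ j)) [mod φ (p ℕ.^ k) ])))
      ⇔ (∀ (x : ℤ) → ℤ.Coprime x (+ p) → eval f x ≋ eval g x [mod p ℕ.^ k ]))
    × ((∀ (x : ℤ) → ℤ.Coprime x (+ p) → eval f x ≋ eval g x [mod p ℕ.^ k ])
      ⇔ (∀ (i : ℕ) → ((1 ≤ i × i ≤ p ∸ 1) ⊎ (p ℕ.+ 1 ≤ i × i ≤ 2 ℕ.* p ∸ 1)) →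
           eval f (+ i) ≋ eval g (+ i) [mod p ℕ.^ k ]))
corollary3p12 p p-prime p≢2 f g f-reduces-well g-reduces-well zero ()
corollary3p12 p p-prime p≢2 f g f-reduces-well g-reduces-well (suc m) _ =
  mk⇔ (TermsMatch⇒AgreeOnUnits m) (AgreeAtTestPoints⇒TermsMatch m ∘ AgreeOnUnits⇒AgreeAtTestPoints (suc m)) ,
  mk⇔ (AgreeOnUnits⇒AgreeAtTestPoints (suc m)) (TermsMatch⇒AgreeOnUnits m ∘ AgreeAtTestPoints⇒TermsMatch m)
  where open Comparison p-prime p≢2 f g f-reduces-well g-reduces-well
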